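{- For all $n\ge 0$, $$|\mathrm{UPF}^{\mathrm{T1}}_{n,2\mathbb{Z}^+}|=\sum_{k=1}^{\lfloor n/2\rfloor}\sum_{i=0}^{2k}\binom{2k}{i}(-1)^i i^n.$$
   Context: $2\mathbb{Z}^+$ is the set of positive even integers. A parking preference $(a_1,\dots,a_n)\in[n]^n$ describes $n$ cars entering a one-way street with spots $1,\dots,n$ in the order $1,2,\dots,n$; car $i$ parks in the first unoccupied spot numbered $\ge a_i$. It is a parking function if all cars park. It is a unit interval parking function if it is a parking function and every car $i$ parks in spot $a_i$ or spot $a_i+1$. Car $i$ is lucky if it parks in spot $a_i$. $\mathrm{UPF}^{\mathrm{T1}}_{n,S}$ is the set of unit interval parking functions of length $n$ whose number of lucky cars belongs to $S$. For $n=0$, the only unit interval parking function is the empty tuple, which has $0$ lucky cars. -}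

module Defs where

open import Data.Nat using (ℕ; zero; suc; _+_; _≤_; _<_; _/_)
open import Data.Nat.Properties using (_≟_; _≤?_)
open import Data.Fin using (Fin; toℕ)
open import Data.Vec using (Vec; []; _∷_; allFin; toList)
open import Data.Vec.Functional using () renaming (Vector to VecF)
open import Data.List using (List; []; _∷_; length; filter; map; concatMap; sum; upTo)
open import Data.List.Membership.DecPropositional _≟_ using (_∈?_)
open import Data.Maybe using (Maybe; just; nothing)
open import Data.Bool using (Bool; true; false; _∧_; if_then_else_)
open import Relation.Nullary using (Dec; yes; no; ¬_)
open import Relation.Nullary.Decidable using (⌊_⌋)
open import Data.Integer as ℤ using (ℤ)
open import Data.Nat.Combinatorics using (_C_)

-- A parking preference of length n: a list of n values, each in [n] = {1,…,n}.
-- We represent preference a_i ∈ [n] by an element of Fin n (value toℕ + 1).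
prefVal : {n : ℕ} → Fin n → ℕ
prefVal i = suc (toℕ i)

firstFree : (n : ℕ) → (occ : List ℕ) → (a : ℕ) → (fuel : ℕ) → Maybe ℕ
firstFree n occ a zero = nothing
firstFree n occ a (suc fuel) with a ≤? n
... | no _ = nothing
... | yes _ with a ∈? occ
...   | yes _ = firstFree n occ (suc a) fuel
...   | no _  = just a

parkAux : (n : ℕ) → List ℕ → List ℕ → Maybe (List ℕ)
parkAux n occ [] = just []
parkAux n occ (a ∷ as) with firstFree n occ a n
... | nothing = nothing
... | just s with parkAux n (s ∷ occ) as
...   | nothing = nothing
...   | just ss = just (s ∷ ss)

prefList : {n : ℕ} → Vec (Fin n) n → List ℕ
prefList v = Data.List.map prefVal (toList v)

outcome : {n : ℕ} → Vec (Fin n) n → Maybe (List ℕ)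
outcome {n} v = parkAux n [] (prefList v)

unitDisplaced : List ℕ → List ℕ → Bool
unitDisplaced [] [] = true
unitDisplaced (a ∷ as) (s ∷ ss) = (⌊ s ≟ a ⌋ Data.Bool.∨ ⌊ s ≟ suc a ⌋) ∧ unitDisplaced as ss
unitDisplaced _ _ = false

luckyCount : List ℕ → List ℕ → ℕ
luckyCount (a ∷ as) (s ∷ ss) = (if ⌊ s ≟ a ⌋ then 1 else 0) + luckyCount as ss
luckyCount _ _ = 0

isUnitIntervalPF : {n : ℕ} → Vec (Fin n) n → Bool
isUnitIntervalPF v with outcome v
... | nothing = false
... | just ss = unitDisplaced (prefList v) ss

lucky : {n : ℕ} → Vec (Fin n) n → ℕ
lucky v with outcome v
... | nothing = 0
... | just ss = luckyCount (prefList v) ss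

allVecs : (n m : ℕ) → List (Vec (Fin n) m)
allVecs n zero = [] ∷ []
allVecs n (suc m) = concatMap (λ x → Data.List.map (x ∷_) (allVecs n m)) (toList (allFin n))

isPosEven : ℕ → Bool
isPosEven zero = false
isPosEven (suc zero) = false
isPosEven (suc (suc k)) = evenB k
  where
  evenB : ℕ → Bool
  evenB zero = true
  evenB (suc zero) = false
  evenB (suc (suc j)) = evenB j

UPF-T1-posEven : (n : ℕ) → List (Vec (Fin n) n)
UPF-T1-posEven n = filter (λ v → isUnitIntervalPF v ∧ isPosEven (lucky v) Data.Bool.≟ true) (allVecs n n)

sumTo : ℕ → (ℕ → ℤ) → ℤ
sumTo zero f = f 0
sumTo (suc m) f = sumTo m f ℤ.+ f (suc m)

sumFrom1 : ℕ → (ℕ → ℤ) → ℤ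
sumFrom1 zero f = ℤ.0ℤ
sumFrom1 (suc m) f = sumFrom1 m f ℤ.+ f (suc m)

signPow : ℕ → ℤ
signPow zero = ℤ.1ℤ
signPow (suc i) = ℤ.- signPow i

rhs : ℕ → ℤ
rhs n = sumFrom1 (n / 2) (λ k → sumTo (2 Data.Nat.* k)
          (λ i → ℤ.+ ((2 Data.Nat.* k) C i) ℤ.* signPow i ℤ.* ℤ.+ (i Data.Nat.^ n)))

module Submission where

-- A preference is read in one pass: car i takes spot a_i if it is free, else spot a_i + 1 if that
-- is free, and otherwise the preference is no unit interval parking function. Let U(n, k) count
-- those of length n with k lucky cars. Deleting the last car and the spot q it takes, and shifting
-- the later spots down, turns one of length n + 1 into one of length n. Conversely, into one of
-- length n with j lucky cars the spot q can be inserted exactly where no car slides in from q − 1: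
-- in front of one of the j lucky cars (one of them in spot 1) or at the end. The last car then
-- parks there luckily in all j + 1 cases and, preferring q − 1, unluckily in the j cases with
-- q ≥ 2. Hence U(n + 1, k) = k (U(n, k − 1) + U(n, k)), the recurrence of the number k! S(n, k) of
-- surjections from an n-set onto a k-set, which inclusion–exclusion writes as
-- (−1)^k Σ_i (−1)^i C(k, i) i^n. Summing over the even k gives the formula.

open import Defs
open import Data.Nat using (ℕ)
open import Data.List using (length)
open import Data.Integer using (+_)
open import Relation.Binary.PropositionalEquality using (_≡_; cong; sym; trans)

module UnitIntervalCounting where
  open import Data.Nat using (ℕ; zero; suc; _+_; _*_; _∸_; _≤_; _<_; s≤s; z≤n; _≤ᵇ_; _≡ᵇ_; _/_; _<?_; s≤s⁻¹)
  open import Data.Nat.Properties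
  open import Data.Bool using (Bool; true; false; _∧_; not; if_then_else_; T)
  open import Data.Bool.Properties using (T-≡; ∧-zeroʳ; ∧-identityʳ; ∧-comm)
  open import Function.Bundles using (Equivalence)
  open import Data.Empty using (⊥; ⊥-elim)
  open import Data.Fin using (Fin; toℕ; punchIn) renaming (zero to fzero; suc to fsuc)
  open import Data.Fin.Properties using (toℕ<n; toℕ-inject₁; toℕ-fromℕ)
  open import Data.List using (List; []; _∷_; _++_)
  import Data.List as List
  open import Data.List.Membership.Propositional using (_∈_; _∉_)
  open import Data.List.Membership.DecPropositional _≟_ using (_∈?_)
  open import Data.List.Relation.Unary.Any using (here; there)
  open import Data.List.Relation.Unary.All using (All; []; _∷_)
  open import Data.Maybe as Maybe using (Maybe; just; nothing)
  open import Data.Product using (_×_; _,_; proj₁; proj₂; map₁; ∃-syntax; uncurry)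
  open import Data.Sum using (_⊎_; inj₁; inj₂; [_,_])
  open import Data.Vec using (Vec; []; _∷_; toList; _∷ʳ_)
  import Data.Vec as Vec
  open import Data.Vec.Membership.Propositional using () renaming (_∈_ to _∈ᵥ_)
  import Data.Vec.Relation.Unary.Any as Anyᵥ
  import Data.Nat.ListAction as ListAction
  open import Data.Nat.ListAction.Properties using (sum-++)
  open import Data.List.Properties using (map-++; map-cong; map-∘)
  open import Algebra.Properties.Semiring.Sum +-*-semiring
    using (sum-syntax; sum-cong-≗; ∑-distrib-+; ∑-comm; sum-remove; sum-init-last; *-distribˡ-sum; sum-replicate-zero)
  open import Data.Nat.DivMod using (m≡m%n+[m/n]*n; m%n<n)
  open import Function using (_∘_)
  open import Algebra.Properties.CommutativeSemigroup +-commutativeSemigroup using (xy∙z≈zy∙x)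
  open import Relation.Nullary using (Dec; yes; no; ¬_)
  open import Relation.Nullary.Decidable using (⌊_⌋)
  open import Relation.Binary.PropositionalEquality hiding ([_])
  open ≡-Reasoning

  𝟙 : Bool → ℕ
  𝟙 true = 1
  𝟙 false = 0

  δ : ℕ → ℕ → ℕ
  δ j k = 𝟙 (j ≡ᵇ k)

  δ-* : ∀ j k → δ j k * j ≡ δ j k * k
  δ-* j k with j ≡ᵇ k in eq
  ... | false = refl
  ... | true = cong (1 *_) (≡ᵇ⇒≡ j k (Equivalence.from T-≡ eq))

  δ-≢ : ∀ {j k} → j ≢ k → δ j k ≡ 0
  δ-≢ {j} {k} j≢k with j ≡ᵇ k in eq
  ... | false = refl
  ... | true = ⊥-elim (j≢k (≡ᵇ⇒≡ j k (Equivalence.from T-≡ eq)))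

  δ-refl : ∀ k → δ k k ≡ 1
  δ-refl k rewrite Equivalence.to T-≡ (≡⇒≡ᵇ k k refl) = refl

  ≤ᵇ-true : ∀ {m n} → m ≤ n → (m ≤ᵇ n) ≡ true
  ≤ᵇ-true m≤n = Equivalence.to T-≡ (≤⇒≤ᵇ m≤n)

  ≤ᵇ-false : ∀ {m n} → n < m → (m ≤ᵇ n) ≡ false
  ≤ᵇ-false {m} {n} n<m with m ≤ᵇ n in eq
  ... | false = refl
  ... | true = ⊥-elim (<⇒≱ n<m (≤ᵇ⇒≤ m n (Equivalence.from T-≡ eq)))

  -- Parking in a single pass

  data Spot : Set where
    free luckyCar unluckyCar : Spot

  isFree isUnlucky : Spot → Bool
  isFree free = true
  isFree _ = false
  isUnlucky unluckyCar = true
  isUnlucky _ = false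

  isLucky isTaken : Spot → Bool
  isLucky luckyCar = true
  isLucky _ = false
  isTaken free = false
  isTaken _ = true

  isFree-taken : ∀ {m} → m ≢ free → isFree m ≡ false
  isFree-taken {free} m≢free = ⊥-elim (m≢free refl)
  isFree-taken {luckyCar} _ = refl
  isFree-taken {unluckyCar} _ = refl

  isTaken-taken : ∀ {m} → m ≢ free → isTaken m ≡ true
  isTaken-taken {free} m≢free = ⊥-elim (m≢free refl)
  isTaken-taken {luckyCar} _ = refl
  isTaken-taken {unluckyCar} _ = refl

  notUnlucky : ∀ {m} → m ≢ unluckyCar → not (isUnlucky m) ≡ true
  notUnlucky {free} _ = refl
  notUnlucky {luckyCar} _ = refl
  notUnlucky {unluckyCar} m≢unlucky = ⊥-elim (m≢unlucky refl)

  notUnlucky≡isLucky : ∀ {m} → m ≢ free → not (isUnlucky m) ≡ isLucky m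
  notUnlucky≡isLucky {free} m≢free = ⊥-elim (m≢free refl)
  notUnlucky≡isLucky {luckyCar} _ = refl
  notUnlucky≡isLucky {unluckyCar} _ = refl

  Street : Set
  Street = ℕ → Spot

  emptyStreet : Street
  emptyStreet _ = free

  park : Street → ℕ → Spot → Street
  park S s m x with x ≟ s
  ... | yes _ = m
  ... | no _ = S x

  park-same : ∀ S s m → park S s m s ≡ m
  park-same S s m with s ≟ s
  ... | yes _ = refl
  ... | no s≢s = ⊥-elim (s≢s refl)

  park-other : ∀ S s m {x} → x ≢ s → park S s m x ≡ S x
  park-other S s m {x} x≢s with x ≟ s
  ... | yes x≡s = ⊥-elim (x≢s x≡s)
  ... | no _ = refl

  park-keeps-taken : ∀ S s m {x} → S x ≢ free → S s ≡ free → park S s m x ≡ S x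
  park-keeps-taken S s m Sx≢free Ss≡free = park-other S s m (λ { refl → Sx≢free Ss≡free })

  park-≢ : ∀ S s k {x m} → S x ≢ m → k ≢ m → park S s k x ≢ m
  park-≢ S s k {x} Sx≢m k≢m = byCases (x ≟ s)
    where
    byCases : Dec (x ≡ s) → park S s k x ≢ _
    byCases (yes refl) eq = k≢m (trans (sym (park-same S x k)) eq)
    byCases (no x≢s) eq = Sx≢m (trans (sym (park-other S s k x≢s)) eq)

  data Move : Set where
    parkHere parkNext stuck : Move

  moveWhenTaken : Spot → Bool → Move
  moveWhenTaken free true = parkNext
  moveWhenTaken _ _ = stuck

  moveAt : Spot → Spot → Bool → Move
  moveAt free _ _ = parkHere
  moveAt _ next fits = moveWhenTaken next fits

  move : ℕ → Street → ℕ → Move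
  move N S a = moveAt (S a) (S (suc a)) (suc a ≤ᵇ N)

  -- Counts the lucky cars, and gives up as soon as a car can take neither its preferred spot nor
  -- the next one: no unit interval parking function can result.
  mutual
    run : ℕ → Street → List ℕ → Maybe (ℕ × Street)
    run N S [] = just (0 , S)
    run N S (a ∷ as) = runAfter (move N S a) N S a as

    runAfter : Move → ℕ → Street → ℕ → List ℕ → Maybe (ℕ × Street)
    runAfter parkHere N S a as = Maybe.map (map₁ suc) (run N (park S a luckyCar) as)
    runAfter parkNext N S a as = run N (park S (suc a) unluckyCar) as
    runAfter stuck N S a as = nothing

  run-∷ : ∀ N S a as {m} → move N S a ≡ m → run N S (a ∷ as) ≡ runAfter m N S a as
  run-∷ N S a as eq = cong (λ m → runAfter m N S a as) eq

  data MoveView (N : ℕ) (S : Street) (a : ℕ) : Set where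
    here : S a ≡ free → move N S a ≡ parkHere → MoveView N S a
    next : S a ≢ free → S (suc a) ≡ free → suc a ≤ N → move N S a ≡ parkNext → MoveView N S a
    blocked : S a ≢ free → S (suc a) ≢ free ⊎ N < suc a → move N S a ≡ stuck → MoveView N S a

  taken : ∀ {x m} → x ≡ m → m ≢ free → x ≢ free
  taken refl m≢free = m≢free

  moveView : ∀ N S a → MoveView N S a
  moveView N S a = view (S a) (S (suc a)) (suc a ≤ᵇ N) refl refl refl
    where
    move≡ : ∀ {m m′ b} → S a ≡ m → S (suc a) ≡ m′ → (suc a ≤ᵇ N) ≡ b → move N S a ≡ moveAt m m′ b
    move≡ refl refl refl = refl
    whenTaken : ∀ m′ b → S a ≢ free → S (suc a) ≡ m′ → (suc a ≤ᵇ N) ≡ b →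
                move N S a ≡ moveWhenTaken m′ b → MoveView N S a
    whenTaken free true ea eb ec e = next ea eb (≤ᵇ⇒≤ (suc a) N (Equivalence.from T-≡ ec)) e
    whenTaken free false ea eb ec e = blocked ea (inj₂ (≰⇒> (λ le → subst T ec (≤⇒≤ᵇ le)))) e
    whenTaken luckyCar b ea eb ec e = blocked ea (inj₁ (taken eb (λ ()))) e
    whenTaken unluckyCar b ea eb ec e = blocked ea (inj₁ (taken eb (λ ()))) e
    view : ∀ m m′ b → S a ≡ m → S (suc a) ≡ m′ → (suc a ≤ᵇ N) ≡ b → MoveView N S a
    view free m′ b ea eb ec = here ea (move≡ ea eb ec)
    view luckyCar m′ b ea eb ec = whenTaken m′ b (taken ea (λ ())) eb ec (move≡ ea eb ec)
    view unluckyCar m′ b ea eb ec = whenTaken m′ b (taken ea (λ ())) eb ec (move≡ ea eb ec)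

  run-here : ∀ N S a as {j S′} → move N S a ≡ parkHere → run N S (a ∷ as) ≡ just (j , S′) →
             ∃[ i ] j ≡ suc i × run N (park S a luckyCar) as ≡ just (i , S′)
  run-here N S a as e eq with run N (park S a luckyCar) as | trans (sym (run-∷ N S a as e)) eq
  ... | just (i , _) | refl = i , refl , refl

  run-next : ∀ N S a as {X} → move N S a ≡ parkNext → run N S (a ∷ as) ≡ X → run N (park S (suc a) unluckyCar) as ≡ X
  run-next N S a as e eq = trans (sym (run-∷ N S a as e)) eq

  run-stuck : ∀ N S a as {X} → move N S a ≡ stuck → run N S (a ∷ as) ≡ just X → ⊥
  run-stuck N S a as e eq with trans (sym (run-∷ N S a as e)) eq
  ... | ()

  -- Agreement with first-free-spot parking

  firstFree-here : ∀ {n o a f} → 0 < f → a ≤ n → a ∉ o → firstFree n o a f ≡ just a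
  firstFree-here {n} {o} {a} {suc f} _ a≤n a∉o with a ≤? n
  ... | no a≰n = ⊥-elim (a≰n a≤n)
  ... | yes _ with a ∈? o
  ...   | yes a∈o = ⊥-elim (a∉o a∈o)
  ...   | no _ = refl

  firstFree-next : ∀ {n o a f} → 1 < f → a ∈ o → suc a ≤ n → suc a ∉ o → firstFree n o a f ≡ just (suc a)
  firstFree-next {f = suc zero} (s≤s ()) _ _ _
  firstFree-next {n} {o} {a} {suc (suc f)} _ a∈o sa≤n sa∉o with a ≤? n
  ... | no a≰n = ⊥-elim (a≰n (≤-trans (n≤1+n a) sa≤n))
  ... | yes _ with a ∈? o
  ...   | no a∉o = ⊥-elim (a∉o a∈o)
  ...   | yes _ = firstFree-here (s≤s z≤n) sa≤n sa∉o

  firstFree-sound : ∀ n o a f {s} → firstFree n o a f ≡ just s → s ∉ o × s ≤ n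
  firstFree-sound n o a (suc f) eq with a ≤? n
  ... | yes a≤n with a ∈? o
  ...   | yes _ = firstFree-sound n o (suc a) f eq
  ...   | no a∉o with eq
  ...     | refl = a∉o , a≤n

  parkAux-∷ : ∀ n o a as {s} → firstFree n o a n ≡ just s →
              parkAux n o (a ∷ as) ≡ Maybe.map (s ∷_) (parkAux n (s ∷ o) as)
  parkAux-∷ n o a as {s} eq rewrite eq with parkAux n (s ∷ o) as
  ... | nothing = refl
  ... | just _ = refl

  unitLucky : List ℕ → Maybe (List ℕ) → Maybe ℕ
  unitLucky as nothing = nothing
  unitLucky as (just ss) = if unitDisplaced as ss then just (luckyCount as ss) else nothing

  ≟-refl : ∀ a → ⌊ a ≟ a ⌋ ≡ true
  ≟-refl a with a ≟ a
  ... | yes _ = refl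
  ... | no a≢a = ⊥-elim (a≢a refl)

  ≟-≢ : ∀ {a b} → a ≢ b → ⌊ a ≟ b ⌋ ≡ false
  ≟-≢ {a} {b} a≢b with a ≟ b
  ... | yes a≡b = ⊥-elim (a≢b a≡b)
  ... | no _ = refl

  unitLucky-here : ∀ a as X → unitLucky (a ∷ as) (Maybe.map (a ∷_) X) ≡ Maybe.map suc (unitLucky as X)
  unitLucky-here a as nothing = refl
  unitLucky-here a as (just ss) rewrite ≟-refl a with unitDisplaced as ss
  ... | true = refl
  ... | false = refl

  unitLucky-next : ∀ a as X → unitLucky (a ∷ as) (Maybe.map (suc a ∷_) X) ≡ unitLucky as X
  unitLucky-next a as nothing = refl
  unitLucky-next a as (just ss) rewrite ≟-refl (suc a) | ≟-≢ (1+n≢n {a}) with unitDisplaced as ss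
  ... | true = refl
  ... | false = refl

  unitLucky-far : ∀ a s as X → s ≢ a → s ≢ suc a → unitLucky (a ∷ as) (Maybe.map (s ∷_) X) ≡ nothing
  unitLucky-far a s as nothing _ _ = refl
  unitLucky-far a s as (just ss) s≢a s≢1+a rewrite ≟-≢ s≢a | ≟-≢ s≢1+a = refl

  unitLucky-blocked : ∀ n o a as → a ∈ o → (∀ s → s ∉ o → s ≤ n → s ≢ suc a) →
                      unitLucky (a ∷ as) (parkAux n o (a ∷ as)) ≡ nothing
  unitLucky-blocked n o a as a∈o noNext = byFirstFree (firstFree n o a n) refl
    where
    byFirstFree : ∀ w → firstFree n o a n ≡ w → unitLucky (a ∷ as) (parkAux n o (a ∷ as)) ≡ nothing
    byFirstFree nothing eq rewrite eq = refl
    byFirstFree (just s) eq = begin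
      unitLucky (a ∷ as) (parkAux n o (a ∷ as))
        ≡⟨ cong (unitLucky (a ∷ as)) (parkAux-∷ n o a as eq) ⟩
      unitLucky (a ∷ as) (Maybe.map (s ∷_) (parkAux n (s ∷ o) as))
        ≡⟨ unitLucky-far a s as (parkAux n (s ∷ o) as) s≢a (noNext s s∉o s≤n) ⟩
      nothing ∎
      where
      s∉o = proj₁ (firstFree-sound n o a n eq)
      s≤n = proj₂ (firstFree-sound n o a n eq)
      s≢a : s ≢ a
      s≢a refl = s∉o a∈o

  Marks : List ℕ → Street → Set
  Marks o S = ∀ x → (x ∈ o → S x ≢ free) × (x ∉ o → S x ≡ free)

  Marks-empty : Marks [] emptyStreet
  Marks-empty x = (λ ()) , (λ _ → refl)

  Marks-park : ∀ {o S} s m → m ≢ free → Marks o S → Marks (s ∷ o) (park S s m)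
  Marks-park {o} {S} s m m≢free marks x with x ≟ s
  ... | yes refl = (λ _ → m≢free) , (λ x∉ → ⊥-elim (x∉ (here refl)))
  ... | no x≢s = (λ { (here x≡s) → ⊥-elim (x≢s x≡s) ; (there x∈o) → proj₁ (marks x) x∈o })
               , (λ x∉ → proj₂ (marks x) (λ x∈o → x∉ (there x∈o)))

  free⇒∉ : ∀ {o S x} → Marks o S → S x ≡ free → x ∉ o
  free⇒∉ {x = x} marks Sx≡free x∈o = proj₁ (marks x) x∈o Sx≡free

  taken⇒∈ : ∀ {o S x} → Marks o S → S x ≢ free → x ∈ o
  taken⇒∈ {o} {x = x} marks Sx≢free with x ∈? o
  ... | yes x∈o = x∈o
  ... | no x∉o = ⊥-elim (Sx≢free (proj₂ (marks x) x∉o))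

  proj₁-map-suc : ∀ (X : Maybe (ℕ × Street)) → Maybe.map proj₁ (Maybe.map (map₁ suc) X) ≡ Maybe.map suc (Maybe.map proj₁ X)
  proj₁-map-suc nothing = refl
  proj₁-map-suc (just _) = refl

  unitLucky∘parkAux≡run : ∀ n o S as → Marks o S → All (λ a → 1 ≤ a × a ≤ n) as →
                          unitLucky as (parkAux n o as) ≡ Maybe.map proj₁ (run n S as)
  unitLucky∘parkAux≡run n o S [] _ _ = refl
  unitLucky∘parkAux≡run n o S (a ∷ as) marks ((1≤a , a≤n) ∷ bounds) with moveView n S a
  ... | here ea e = begin
    unitLucky (a ∷ as) (parkAux n o (a ∷ as))
      ≡⟨ cong (unitLucky (a ∷ as)) (parkAux-∷ n o a as (firstFree-here (≤-trans 1≤a a≤n) a≤n (free⇒∉ marks ea))) ⟩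
    unitLucky (a ∷ as) (Maybe.map (a ∷_) (parkAux n (a ∷ o) as))
      ≡⟨ unitLucky-here a as (parkAux n (a ∷ o) as) ⟩
    Maybe.map suc (unitLucky as (parkAux n (a ∷ o) as))
      ≡⟨ cong (Maybe.map suc) (unitLucky∘parkAux≡run n (a ∷ o) S′ as (Marks-park a luckyCar (λ ()) marks) bounds) ⟩
    Maybe.map suc (Maybe.map proj₁ (run n S′ as))
      ≡⟨ proj₁-map-suc (run n S′ as) ⟨
    Maybe.map proj₁ (Maybe.map (map₁ suc) (run n S′ as))
      ≡⟨ cong (Maybe.map proj₁) (run-∷ n S a as e) ⟨
    Maybe.map proj₁ (run n S (a ∷ as)) ∎
    where S′ = park S a luckyCar
  ... | next na eb sa≤n e = begin
    unitLucky (a ∷ as) (parkAux n o (a ∷ as))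
      ≡⟨ cong (unitLucky (a ∷ as)) (parkAux-∷ n o a as
           (firstFree-next (≤-trans (s≤s 1≤a) sa≤n) (taken⇒∈ marks na) sa≤n (free⇒∉ marks eb))) ⟩
    unitLucky (a ∷ as) (Maybe.map (suc a ∷_) (parkAux n (suc a ∷ o) as))
      ≡⟨ unitLucky-next a as (parkAux n (suc a ∷ o) as) ⟩
    unitLucky as (parkAux n (suc a ∷ o) as)
      ≡⟨ unitLucky∘parkAux≡run n (suc a ∷ o) _ as (Marks-park (suc a) unluckyCar (λ ()) marks) bounds ⟩
    Maybe.map proj₁ (run n (park S (suc a) unluckyCar) as)
      ≡⟨ cong (Maybe.map proj₁) (run-∷ n S a as e) ⟨
    Maybe.map proj₁ (run n S (a ∷ as)) ∎
  ... | blocked na nextBlocked e =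
    trans (unitLucky-blocked n o a as (taken⇒∈ marks na) noNext) (cong (Maybe.map proj₁) (sym (run-∷ n S a as e)))
    where
    noNext : ∀ s → s ∉ o → s ≤ n → s ≢ suc a
    noNext s s∉o s≤n refl = [ (λ sa≢free → s∉o (taken⇒∈ marks sa≢free)) , (λ n<sa → <⇒≱ n<sa s≤n) ] nextBlocked

  sumVecs : (N m : ℕ) → (Vec (Fin N) m → ℕ) → ℕ
  sumVecs N zero g = g []
  sumVecs N (suc m) g = ∑[ x < N ] sumVecs N m (λ w → g (x ∷ w))

  sumVecs-cong : ∀ N m {f g : Vec (Fin N) m → ℕ} → (∀ v → f v ≡ g v) → sumVecs N m f ≡ sumVecs N m g
  sumVecs-cong N zero f≗g = f≗g []
  sumVecs-cong N (suc m) f≗g = sum-cong-≗ (λ x → sumVecs-cong N m (λ w → f≗g (x ∷ w)))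

  sumVecs-zero : ∀ N m {f : Vec (Fin N) m → ℕ} → (∀ v → f v ≡ 0) → sumVecs N m f ≡ 0
  sumVecs-zero N zero f≗0 = f≗0 []
  sumVecs-zero N (suc m) f≗0 =
    trans (sum-cong-≗ (λ x → sumVecs-zero N m (λ w → f≗0 (x ∷ w)))) (sum-replicate-zero N)

  sumVecs-comm : ∀ N m K (h : Vec (Fin N) m → Fin K → ℕ) →
                 sumVecs N m (λ w → ∑[ y < K ] h w y) ≡ ∑[ y < K ] sumVecs N m (λ w → h w y)
  sumVecs-comm N zero K h = refl
  sumVecs-comm N (suc m) K h =
    trans (sum-cong-≗ (λ x → sumVecs-comm N m K (λ w → h (x ∷ w)))) (∑-comm (λ x y → sumVecs N m (λ w → h (x ∷ w) y)))

  sumVecs-distrib-+ : ∀ N m (f g : Vec (Fin N) m → ℕ) → sumVecs N m (λ v → f v + g v) ≡ sumVecs N m f + sumVecs N m g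
  sumVecs-distrib-+ N zero f g = refl
  sumVecs-distrib-+ N (suc m) f g =
    trans (sum-cong-≗ (λ x → sumVecs-distrib-+ N m (λ w → f (x ∷ w)) (λ w → g (x ∷ w))))
          (∑-distrib-+ (λ x → sumVecs N m (λ w → f (x ∷ w))) (λ x → sumVecs N m (λ w → g (x ∷ w))))

  *-distribˡ-sumVecs : ∀ N m c (f : Vec (Fin N) m → ℕ) → c * sumVecs N m f ≡ sumVecs N m (λ v → c * f v)
  *-distribˡ-sumVecs N zero c f = refl
  *-distribˡ-sumVecs N (suc m) c f =
    trans (*-distribˡ-sum c (λ x → sumVecs N m (λ w → f (x ∷ w))))
          (sum-cong-≗ (λ x → *-distribˡ-sumVecs N m c (λ w → f (x ∷ w))))

  sumVecs-∷ʳ : ∀ N m (g : Vec (Fin N) (suc m) → ℕ) → sumVecs N (suc m) g ≡ sumVecs N m (λ w → ∑[ x < N ] g (w ∷ʳ x))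
  sumVecs-∷ʳ N zero g = refl
  sumVecs-∷ʳ N (suc m) g = sum-cong-≗ (λ x → sumVecs-∷ʳ N m (λ w → g (x ∷ w)))

  sumVecs-punchIn : ∀ N m (i : Fin (suc N)) (g : Vec (Fin (suc N)) m → ℕ) → (∀ w → i ∈ᵥ w → g w ≡ 0) →
                    sumVecs (suc N) m g ≡ sumVecs N m (g ∘ Vec.map (punchIn i))
  sumVecs-punchIn N zero i g _ = refl
  sumVecs-punchIn N (suc m) i g vanishes = begin
    ∑[ x < suc N ] sumVecs (suc N) m (λ w → g (x ∷ w))
      ≡⟨ sum-remove {i = i} (λ x → sumVecs (suc N) m (λ w → g (x ∷ w))) ⟩
    sumVecs (suc N) m (λ w → g (i ∷ w)) + rest
      ≡⟨ cong (_+ rest) (sumVecs-zero (suc N) m (λ w → vanishes (i ∷ w) (Anyᵥ.here refl))) ⟩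
    rest
      ≡⟨ sum-cong-≗ (λ y → sumVecs-punchIn N m i (λ w → g (punchIn i y ∷ w))
                                (λ w i∈w → vanishes (punchIn i y ∷ w) (Anyᵥ.there i∈w))) ⟩
    sumVecs N (suc m) (g ∘ Vec.map (punchIn i)) ∎
    where rest = ∑[ y < N ] sumVecs (suc N) m (λ w → g (punchIn i y ∷ w))

  sum-map-allVecs : ∀ N m (g : Vec (Fin N) m → ℕ) → ListAction.sum (List.map g (allVecs N m)) ≡ sumVecs N m g
  sum-map-allVecs N zero g = +-identityʳ (g [])
  sum-map-allVecs N (suc m) g = begin
    ListAction.sum (List.map g (List.concatMap (λ x → List.map (x ∷_) (allVecs N m)) (toList (Vec.allFin N))))
      ≡⟨ sum-map-concatMap (toList (Vec.allFin N)) ⟩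
    ListAction.sum (List.map (λ x → ListAction.sum (List.map g (List.map (x ∷_) (allVecs N m)))) (toList (Vec.allFin N)))
      ≡⟨ cong ListAction.sum (map-cong (λ x → cong ListAction.sum (sym (map-∘ (allVecs N m)))) (toList (Vec.allFin N))) ⟩
    ListAction.sum (List.map (λ x → ListAction.sum (List.map (g ∘ (x ∷_)) (allVecs N m))) (toList (Vec.allFin N)))
      ≡⟨ sum-tabulate N (λ x → ListAction.sum (List.map (g ∘ (x ∷_)) (allVecs N m))) (λ x → x) ⟩
    ∑[ x < N ] ListAction.sum (List.map (g ∘ (x ∷_)) (allVecs N m))
      ≡⟨ sum-cong-≗ (λ x → sum-map-allVecs N m (g ∘ (x ∷_))) ⟩
    sumVecs N (suc m) g ∎
    where
    sum-map-concatMap : ∀ {A : Set} {k : A → List (Vec (Fin N) (suc m))} xs →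
      ListAction.sum (List.map g (List.concatMap k xs)) ≡ ListAction.sum (List.map (λ x → ListAction.sum (List.map g (k x))) xs)
    sum-map-concatMap [] = refl
    sum-map-concatMap {k = k} (x ∷ xs) = begin
      ListAction.sum (List.map g (k x ++ List.concatMap k xs))
        ≡⟨ cong ListAction.sum (map-++ g (k x) _) ⟩
      ListAction.sum (List.map g (k x) ++ List.map g (List.concatMap k xs))
        ≡⟨ sum-++ (List.map g (k x)) _ ⟩
      ListAction.sum (List.map g (k x)) + ListAction.sum (List.map g (List.concatMap k xs))
        ≡⟨ cong (λ y → ListAction.sum (List.map g (k x)) + y) (sum-map-concatMap xs) ⟩
      ListAction.sum (List.map g (k x)) + ListAction.sum (List.map (λ x → ListAction.sum (List.map g (k x))) xs) ∎
    sum-tabulate : ∀ {A : Set} K (f : A → ℕ) (t : Fin K → A) →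
                   ListAction.sum (List.map f (toList (Vec.tabulate t))) ≡ ∑[ x < K ] f (t x)
    sum-tabulate zero f t = refl
    sum-tabulate (suc K) f t = cong (λ y → f (t fzero) + y) (sum-tabulate K f (t ∘ fsuc))

  sumBelow : ℕ → (ℕ → ℕ) → ℕ
  sumBelow M f = ∑[ i < M ] f (toℕ i)

  sumBelow-cong : ∀ M {f g : ℕ → ℕ} → (∀ t → t < M → f t ≡ g t) → sumBelow M f ≡ sumBelow M g
  sumBelow-cong M f≗g = sum-cong-≗ {M} (λ i → f≗g (toℕ i) (toℕ<n i))

  sumBelow-distrib-+ : ∀ M (f g : ℕ → ℕ) → sumBelow M (λ t → f t + g t) ≡ sumBelow M f + sumBelow M g
  sumBelow-distrib-+ M f g = ∑-distrib-+ {M} (f ∘ toℕ) (g ∘ toℕ)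

  sumBelow-suc : ∀ M f → sumBelow (suc M) f ≡ sumBelow M f + f M
  sumBelow-suc M f = trans (sum-init-last {M} (f ∘ toℕ))
    (cong₂ _+_ (sum-cong-≗ {M} (λ i → cong f (toℕ-inject₁ i))) (cong f (toℕ-fromℕ M)))

  sumBelow-shift : ∀ M (f g : ℕ → ℕ) → g 0 ≡ 0 → f M ≡ 0 → (∀ t → t < M → f t ≡ g (suc t)) →
                   sumBelow (suc M) f ≡ sumBelow (suc M) g
  sumBelow-shift M f g g0≡0 fM≡0 f≗g∘suc = begin
    sumBelow (suc M) f       ≡⟨ sumBelow-suc M f ⟩
    sumBelow M f + f M       ≡⟨ cong (λ y → sumBelow M f + y) fM≡0 ⟩
    sumBelow M f + 0         ≡⟨ +-identityʳ _ ⟩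
    sumBelow M f             ≡⟨ sumBelow-cong M f≗g∘suc ⟩
    sumBelow M (g ∘ suc)     ≡⟨ cong (_+ sumBelow M (g ∘ suc)) g0≡0 ⟨
    sumBelow (suc M) g       ∎

  sumBelow-update : ∀ M c (f f′ : ℕ → ℕ) → c < M → (∀ t → t ≢ c → f′ t ≡ f t) →
                    sumBelow M f′ + f c ≡ sumBelow M f + f′ c
  sumBelow-update (suc M) zero f f′ _ agree
    rewrite sumBelow-cong M {f′ ∘ suc} {f ∘ suc} (λ t _ → agree (suc t) (λ ())) =
    xy∙z≈zy∙x (f′ 0) (sumBelow M (f ∘ suc)) (f 0)
  sumBelow-update (suc M) (suc c) f f′ (s≤s c<M) agree rewrite agree 0 (λ ()) =
    trans (+-assoc (f 0) _ _)
    (trans (cong (λ y → f 0 + y)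
                 (sumBelow-update M c (f ∘ suc) (f′ ∘ suc) c<M (λ t t≢c → agree (suc t) (t≢c ∘ suc-injective))))
    (sym (+-assoc (f 0) _ _)))

  sumBelow-𝟙≤ : ∀ M (b : ℕ → Bool) → sumBelow M (𝟙 ∘ b) ≤ M
  sumBelow-𝟙≤ zero b = z≤n
  sumBelow-𝟙≤ (suc M) b = +-mono-≤ (𝟙≤1 (b 0)) (sumBelow-𝟙≤ M (b ∘ suc))
    where
    𝟙≤1 : ∀ x → 𝟙 x ≤ 1
    𝟙≤1 true = ≤-refl
    𝟙≤1 false = z≤n

  sumBelow-𝟙≡⇒all : ∀ M (b : ℕ → Bool) → sumBelow M (𝟙 ∘ b) ≡ M → ∀ t → t < M → b t ≡ true
  sumBelow-𝟙≡⇒all (suc M) b full t t<M with b 0 in b0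
  ... | false = ⊥-elim (<-irrefl refl (≤-trans (≤-reflexive (sym full)) (sumBelow-𝟙≤ M (b ∘ suc))))
  sumBelow-𝟙≡⇒all (suc M) b full zero _ | true = b0
  sumBelow-𝟙≡⇒all (suc M) b full (suc t) (s≤s t<M) | true = sumBelow-𝟙≡⇒all M (b ∘ suc) (suc-injective full) t t<M

  sumFrom1ℕ : ℕ → (ℕ → ℕ) → ℕ
  sumFrom1ℕ zero f = 0
  sumFrom1ℕ (suc m) f = sumFrom1ℕ m f + f (suc m)

  sumFrom1ℕ-cong : ∀ m {f g : ℕ → ℕ} → (∀ k → f k ≡ g k) → sumFrom1ℕ m f ≡ sumFrom1ℕ m g
  sumFrom1ℕ-cong zero _ = refl
  sumFrom1ℕ-cong (suc m) f≗g = cong₂ _+_ (sumFrom1ℕ-cong m f≗g) (f≗g (suc m))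

  sumFrom1ℕ-zero : ∀ m (f : ℕ → ℕ) → (∀ k → k ≤ m → f k ≡ 0) → sumFrom1ℕ m f ≡ 0
  sumFrom1ℕ-zero zero f _ = refl
  sumFrom1ℕ-zero (suc m) f f≡0 rewrite f≡0 (suc m) ≤-refl =
    trans (+-identityʳ _) (sumFrom1ℕ-zero m f (λ k k≤m → f≡0 k (m≤n⇒m≤1+n k≤m)))

  sumVecs-sumFrom1ℕ : ∀ N m M (g : ℕ → Vec (Fin N) m → ℕ) →
                      sumVecs N m (λ v → sumFrom1ℕ M (λ k → g k v)) ≡ sumFrom1ℕ M (λ k → sumVecs N m (g k))
  sumVecs-sumFrom1ℕ N m zero g = sumVecs-zero N m (λ _ → refl)
  sumVecs-sumFrom1ℕ N m (suc M) g =
    trans (sumVecs-distrib-+ N m _ (g (suc M))) (cong (_+ sumVecs N m (g (suc M))) (sumVecs-sumFrom1ℕ N m M g))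

  weigh : (ℕ → Street → ℕ) → Maybe (ℕ × Street) → ℕ
  weigh F = Maybe.maybe′ (uncurry F) 0

  weigh-cong : ∀ {F G} X → (∀ j S → X ≡ just (j , S) → F j S ≡ G j S) → weigh F X ≡ weigh G X
  weigh-cong nothing _ = refl
  weigh-cong (just (j , S)) F≗G = F≗G j S refl

  weigh-vanishes : ∀ {F} X → (∀ j S → X ≡ just (j , S) → F j S ≡ 0) → weigh F X ≡ 0
  weigh-vanishes nothing _ = refl
  weigh-vanishes (just (j , S)) F≗0 = F≗0 j S refl

  weigh-map-suc : ∀ F X → weigh F (Maybe.map (map₁ suc) X) ≡ weigh (F ∘ suc) X
  weigh-map-suc F nothing = refl
  weigh-map-suc F (just _) = refl

  weigh-sum : ∀ K (G : Fin K → ℕ → Street → ℕ) X → ∑[ x < K ] weigh (G x) X ≡ weigh (λ j S → ∑[ x < K ] G x j S) X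
  weigh-sum K G nothing = sum-replicate-zero K
  weigh-sum K G (just _) = refl

  weigh-sumFrom1ℕ : ∀ M (F : ℕ → ℕ → Street → ℕ) X →
                    weigh (λ j S → sumFrom1ℕ M (λ k → F k j S)) X ≡ sumFrom1ℕ M (λ k → weigh (F k) X)
  weigh-sumFrom1ℕ M F nothing = sym (sumFrom1ℕ-zero M _ (λ _ _ → refl))
  weigh-sumFrom1ℕ M F (just _) = refl

  weigh-run-here : ∀ N S a as F → move N S a ≡ parkHere →
                   weigh F (run N S (a ∷ as)) ≡ weigh (F ∘ suc) (run N (park S a luckyCar) as)
  weigh-run-here N S a as F e = trans (cong (weigh F) (run-∷ N S a as e)) (weigh-map-suc F (run N (park S a luckyCar) as))

  weigh-run-next : ∀ N S a as F → move N S a ≡ parkNext →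
                   weigh F (run N S (a ∷ as)) ≡ weigh F (run N (park S (suc a) unluckyCar) as)
  weigh-run-next N S a as F e = cong (weigh F) (run-∷ N S a as e)

  weigh-run-stuck : ∀ N S a as F → move N S a ≡ stuck → weigh F (run N S (a ∷ as)) ≡ 0
  weigh-run-stuck N S a as F e = cong (weigh F) (run-∷ N S a as e)

  run-preserves-taken : ∀ N S as {x j S′} → S x ≢ free → run N S as ≡ just (j , S′) → S′ x ≡ S x
  run-preserves-taken N S [] _ refl = refl
  run-preserves-taken N S (a ∷ as) Sx≢free eq with moveView N S a
  ... | here ea e with run-here N S a as e eq
  ...   | _ , _ , eq′ = trans (run-preserves-taken N _ as (taken kept Sx≢free) eq′) kept
    where kept = park-keeps-taken S a luckyCar Sx≢free ea
  run-preserves-taken N S (a ∷ as) Sx≢free eq | next _ eb _ e =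
    trans (run-preserves-taken N _ as (taken kept Sx≢free) (run-next N S a as e eq)) kept
    where kept = park-keeps-taken S (suc a) unluckyCar Sx≢free eb
  run-preserves-taken N S (a ∷ as) Sx≢free eq | blocked _ _ e = ⊥-elim (run-stuck N S a as e eq)

  run-takes-preferences : ∀ N S as {p j S′} → p ∈ as → run N S as ≡ just (j , S′) → S′ p ≢ free
  run-takes-preferences N S (a ∷ as) p∈ eq with moveView N S a | p∈
  ... | here ea e | here refl with run-here N S a as e eq
  ...   | _ , _ , eq′ =
    taken (trans (run-preserves-taken N _ as (taken (park-same S a luckyCar) (λ ())) eq′) (park-same S a luckyCar)) (λ ())
  run-takes-preferences N S (a ∷ as) p∈ eq | here ea e | there p∈as with run-here N S a as e eq
  ...   | _ , _ , eq′ = run-takes-preferences N _ as p∈as eq′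
  run-takes-preferences N S (a ∷ as) p∈ eq | next na _ _ e | here refl =
    taken (trans (run-preserves-taken N _ as (taken kept na) (run-next N S a as e eq)) kept) na
    where kept = park-other S (suc a) unluckyCar (1+n≢n ∘ sym)
  run-takes-preferences N S (a ∷ as) p∈ eq | next _ _ _ e | there p∈as = run-takes-preferences N _ as p∈as (run-next N S a as e eq)
  run-takes-preferences N S (a ∷ as) p∈ eq | blocked _ _ e | _ = ⊥-elim (run-stuck N S a as e eq)

  weigh-run-park : ∀ N S s k as {F} → k ≢ free → (∀ j {S′} → S′ s ≡ k → F j S′ ≡ 0) →
                   weigh F (run N (park S s k) as) ≡ 0
  weigh-run-park N S s k as k≢free F≡0 = weigh-vanishes (run N (park S s k) as)
    (λ j S′ eq → F≡0 j (trans (run-preserves-taken N _ as (taken (park-same S s k) k≢free) eq) (park-same S s k)))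

  record Occupancy (M : ℕ) (S : Street) (m j : ℕ) : Set where
    field
      inRange : ∀ x → S x ≢ free → 1 ≤ x × x ≤ M
      #lucky : sumBelow M (λ t → 𝟙 (isLucky (S (suc t)))) ≡ j
      #taken : sumBelow M (λ t → 𝟙 (isTaken (S (suc t)))) ≡ m
      unlucky≥2 : ∀ x → S x ≡ unluckyCar → 2 ≤ x

  Occupancy-empty : ∀ M → Occupancy M emptyStreet 0 0
  Occupancy-empty M = record
    { inRange = λ x free≢free → ⊥-elim (free≢free refl)
    ; #lucky = sum-replicate-zero M
    ; #taken = sum-replicate-zero M
    ; unlucky≥2 = λ x () }

  sumBelow-park : ∀ M S c k (g : Spot → ℕ) → c < M → S (suc c) ≡ free → g free ≡ 0 →
                  sumBelow M (λ t → g (park S (suc c) k (suc t))) ≡ sumBelow M (λ t → g (S (suc t))) + g k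
  sumBelow-park M S c k g c<M Sc≡free gfree≡0 = begin
    sumBelow M (g ∘ S′ ∘ suc)
      ≡⟨ +-identityʳ _ ⟨
    sumBelow M (g ∘ S′ ∘ suc) + 0
      ≡⟨ cong (λ y → sumBelow M (g ∘ S′ ∘ suc) + y) (trans (cong g Sc≡free) gfree≡0) ⟨
    sumBelow M (g ∘ S′ ∘ suc) + g (S (suc c))
      ≡⟨ sumBelow-update M c (g ∘ S ∘ suc) (g ∘ S′ ∘ suc) c<M
           (λ t t≢c → cong g (park-other S (suc c) k (t≢c ∘ suc-injective))) ⟩
    sumBelow M (g ∘ S ∘ suc) + g (S′ (suc c))
      ≡⟨ cong (λ y → sumBelow M (g ∘ S ∘ suc) + g y) (park-same S (suc c) k) ⟩
    sumBelow M (g ∘ S ∘ suc) + g k ∎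
    where S′ = park S (suc c) k

  Occupancy-park : ∀ {M S m j} b k → 1 ≤ b → b ≤ M → S b ≡ free → k ≢ free → (k ≡ unluckyCar → 2 ≤ b) →
                   Occupancy M S m j → Occupancy M (park S b k) (suc m) (j + 𝟙 (isLucky k))
  Occupancy-park {M} {S} {m} {j} (suc c) k _ b≤M Sb≡free k≢free unlucky⇒b≥2 occ = record
    { inRange = inRange′
    ; #lucky = trans (sumBelow-park M S c k (𝟙 ∘ isLucky) b≤M Sb≡free refl) (cong (_+ 𝟙 (isLucky k)) #lucky)
    ; #taken = trans (sumBelow-park M S c k (𝟙 ∘ isTaken) b≤M Sb≡free refl)
                     (trans (cong₂ _+_ #taken (cong 𝟙 (isTaken-taken k≢free))) (+-comm m 1))
    ; unlucky≥2 = unlucky≥2′ }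
    where
    open Occupancy occ
    inRange′ : ∀ x → park S (suc c) k x ≢ free → 1 ≤ x × x ≤ M
    inRange′ x x≢free = byCases (x ≟ suc c)
      where
      byCases : Dec (x ≡ suc c) → 1 ≤ x × x ≤ M
      byCases (yes refl) = s≤s z≤n , b≤M
      byCases (no x≢b) = inRange x (λ q → x≢free (trans (park-other S (suc c) k x≢b) q))
    unlucky≥2′ : ∀ x → park S (suc c) k x ≡ unluckyCar → 2 ≤ x
    unlucky≥2′ x eq = byCases (x ≟ suc c)
      where
      byCases : Dec (x ≡ suc c) → 2 ≤ x
      byCases (yes refl) = unlucky⇒b≥2 (trans (sym (park-same S (suc c) k)) eq)
      byCases (no x≢b) = unlucky≥2 x (trans (sym (park-other S (suc c) k x≢b)) eq)

  run-Occupancy : ∀ M S as {m j i S′} → Occupancy M S m j → All (λ a → 1 ≤ a × a ≤ M) as →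
                  run M S as ≡ just (i , S′) → Occupancy M S′ (m + List.length as) (j + i)
  run-Occupancy M S [] {m} {j} occ _ refl rewrite +-identityʳ m | +-identityʳ j = occ
  run-Occupancy M S (a ∷ as) {m} {j} occ ((1≤a , a≤M) ∷ bounds) eq with moveView M S a
  ... | here ea e with run-here M S a as e eq
  ...   | i , refl , eq′ = subst₂ (Occupancy M _) (sym (+-suc m (List.length as))) (+-assoc j 1 i)
            (run-Occupancy M _ as (Occupancy-park a luckyCar 1≤a a≤M ea (λ ()) (λ ()) occ) bounds eq′)
  run-Occupancy M S (a ∷ as) {m} {j} {i} occ ((1≤a , a≤M) ∷ bounds) eq | next _ eb sa≤M e =
    subst₂ (Occupancy M _) (sym (+-suc m (List.length as))) (cong (_+ i) (+-identityʳ j))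
      (run-Occupancy M _ as (Occupancy-park (suc a) unluckyCar (s≤s z≤n) sa≤M eb (λ ()) (λ _ → s≤s 1≤a) occ) bounds
        (run-next M S a as e eq))
  run-Occupancy M S (a ∷ as) occ _ eq | blocked _ _ e = ⊥-elim (run-stuck M S a as e eq)

  -- Deleting a free spot

  punchInℕ : ℕ → ℕ → ℕ
  punchInℕ p s with s <? p
  ... | yes _ = s
  ... | no _ = suc s

  punchInℕ-< : ∀ {p s} → s < p → punchInℕ p s ≡ s
  punchInℕ-< {p} {s} s<p with s <? p
  ... | yes _ = refl
  ... | no s≮p = ⊥-elim (s≮p s<p)

  punchInℕ-≥ : ∀ {p s} → p ≤ s → punchInℕ p s ≡ suc s
  punchInℕ-≥ {p} {s} p≤s with s <? p
  ... | yes s<p = ⊥-elim (<⇒≱ s<p p≤s)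
  ... | no _ = refl

  punchInℕ-≢ : ∀ p s → punchInℕ p s ≢ p
  punchInℕ-≢ p s with s <? p
  ... | yes s<p = λ s≡p → <-irrefl s≡p s<p
  ... | no s≮p = λ 1+s≡p → s≮p (subst (s <_) 1+s≡p (n<1+n s))

  punchInℕ-injective : ∀ p s t → punchInℕ p s ≡ punchInℕ p t → s ≡ t
  punchInℕ-injective p s t eq with s <? p | t <? p
  ... | yes _ | yes _ = eq
  ... | no _ | no _ = suc-injective eq
  ... | yes s<p | no t≮p = ⊥-elim (t≮p (<-trans (subst (t <_) (sym eq) (n<1+n t)) s<p))
  ... | no s≮p | yes t<p = ⊥-elim (s≮p (<-trans (subst (s <_) eq (n<1+n s)) t<p))

  punchInℕ-suc : ∀ p a → suc a ≢ p → suc (punchInℕ p a) ≡ punchInℕ p (suc a)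
  punchInℕ-suc p a 1+a≢p with a <? p
  ... | yes a<p = sym (punchInℕ-< (≤∧≢⇒< a<p 1+a≢p))
  ... | no a≮p = sym (punchInℕ-≥ (≤-trans (≮⇒≥ a≮p) (n≤1+n a)))

  punchInℕ-≤ : ∀ p s → punchInℕ p s ≤ suc s
  punchInℕ-≤ p s with s <? p
  ... | yes _ = n≤1+n s
  ... | no _ = ≤-refl

  punchInℕ-≤ᵇ : ∀ {p n} x → p ≤ suc n → (punchInℕ p x ≤ᵇ suc n) ≡ (x ≤ᵇ n)
  punchInℕ-≤ᵇ {p} {n} x p≤1+n with x ≤? n
  ... | yes x≤n = trans (≤ᵇ-true (≤-trans (punchInℕ-≤ p x) (s≤s x≤n))) (sym (≤ᵇ-true x≤n))
  ... | no x≰n = trans (≤ᵇ-false (subst (suc n <_) (sym (punchInℕ-≥ (≤-trans p≤1+n n<x))) (s≤s n<x))) (sym (≤ᵇ-false n<x))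
    where n<x = ≰⇒> x≰n

  prefVal-punchIn : ∀ {N} (i : Fin (suc N)) (y : Fin N) → prefVal (punchIn i y) ≡ punchInℕ (prefVal i) (prefVal y)
  prefVal-punchIn fzero y = sym (punchInℕ-≥ (s≤s z≤n))
  prefVal-punchIn (fsuc i) fzero = sym (punchInℕ-< {suc (prefVal i)} {1} (s≤s (s≤s z≤n)))
  prefVal-punchIn (fsuc i) (fsuc y) = trans (cong suc (prefVal-punchIn i y)) (sym (punchInℕ-suc-suc (prefVal i) (prefVal y)))
    where
    punchInℕ-suc-suc : ∀ p s → punchInℕ (suc p) (suc s) ≡ suc (punchInℕ p s)
    punchInℕ-suc-suc p s with s <? p
    ... | yes s<p = punchInℕ-< (s≤s s<p)
    ... | no s≮p = punchInℕ-≥ (s≤s (≮⇒≥ s≮p))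

  record GapAt (p : ℕ) (S S′ : Street) : Set where
    constructor _,_
    field
      gapFree : S′ p ≡ free
      agree : ∀ s → S′ (punchInℕ p s) ≡ S s

  GapAt-park : ∀ {p S S′} s k → GapAt p S S′ → GapAt p (park S s k) (park S′ (punchInℕ p s) k)
  GapAt-park {p} {S} {S′} s k (gap , agree) = trans (park-other S′ _ k (punchInℕ-≢ p s ∘ sym)) gap , agree′
    where
    agree′ : ∀ t → park S′ (punchInℕ p s) k (punchInℕ p t) ≡ park S s k t
    agree′ t = byCases (t ≟ s)
      where
      byCases : Dec (t ≡ s) → park S′ (punchInℕ p s) k (punchInℕ p t) ≡ park S s k t
      byCases (yes refl) = trans (park-same S′ (punchInℕ p t) k) (sym (park-same S t k))
      byCases (no t≢s) = trans (park-other S′ _ k (t≢s ∘ punchInℕ-injective p t s))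
                               (trans (agree t) (sym (park-other S s k t≢s)))

  move-gap : ∀ {n p S S′} a → p ≤ suc n → GapAt p S S′ → suc a ≢ p → move (suc n) S′ (punchInℕ p a) ≡ move n S a
  move-gap {n} {p} {S} {S′} a p≤1+n (_ , agree) 1+a≢p = begin
    moveAt (S′ a′) (S′ (suc a′)) (suc a′ ≤ᵇ suc n)
      ≡⟨ cong (λ x → moveAt (S′ a′) (S′ x) (x ≤ᵇ suc n)) (punchInℕ-suc p a 1+a≢p) ⟩
    moveAt (S′ a′) (S′ (punchInℕ p (suc a))) (punchInℕ p (suc a) ≤ᵇ suc n)
      ≡⟨ cong (λ m → moveAt m _ _) (agree a) ⟩
    moveAt (S a) (S′ (punchInℕ p (suc a))) (punchInℕ p (suc a) ≤ᵇ suc n)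
      ≡⟨ cong₂ (moveAt (S a)) (agree (suc a)) (punchInℕ-≤ᵇ (suc a) p≤1+n) ⟩
    moveAt (S a) (S (suc a)) (suc a ≤ᵇ n) ∎
    where a′ = punchInℕ p a

  record CompatibleAt (p : ℕ) (F F′ : ℕ → Street → ℕ) : Set where
    field
      agreeOnGap : ∀ j {S S′} → GapAt p S S′ → S p ≢ unluckyCar → F j S′ ≡ F′ j S
      gapTaken : ∀ j {S′} → S′ p ≢ free → F j S′ ≡ 0
      gapUnlucky : ∀ j {S} → S p ≡ unluckyCar → F′ j S ≡ 0

  CompatibleAt-suc : ∀ {p F F′} → CompatibleAt p F F′ → CompatibleAt p (F ∘ suc) (F′ ∘ suc)
  CompatibleAt-suc c = record
    { agreeOnGap = agreeOnGap ∘ suc ; gapTaken = gapTaken ∘ suc ; gapUnlucky = gapUnlucky ∘ suc }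
    where open CompatibleAt c

  weigh-run-intoTaken : ∀ N S a as {F} → (∀ j {S′} → S′ (suc a) ≢ free → F j S′ ≡ 0) → S a ≢ free →
                        weigh F (run N S (a ∷ as)) ≡ 0
  weigh-run-intoTaken N S a as {F} F≡0 Sa≢free with moveView N S a
  ... | here ea _ = ⊥-elim (Sa≢free ea)
  ... | next _ _ _ e = trans (weigh-run-next N S a as F e)
                             (weigh-run-park N S (suc a) unluckyCar as (λ ()) (λ j eq → F≡0 j (taken eq (λ ()))))
  ... | blocked _ _ e = weigh-run-stuck N S a as F e

  -- Inserting a free spot p into the street and relabelling the preferences around it changes the
  -- run only when a car slides from p − 1 onto p: in the longer street it fills the gap, where F
  -- vanishes, and in the shorter one it parks unluckily on p, where F′ vanishes.
  weigh-run-gap : ∀ {n p} → p ≤ suc n → ∀ {F F′} → CompatibleAt p F F′ →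
                  ∀ u {S S′} → GapAt p S S′ → S p ≢ unluckyCar →
                  weigh F (run (suc n) S′ (List.map (punchInℕ p) u)) ≡ weigh F′ (run n S u)
  weigh-run-gap p≤1+n c [] gap Sp≢unlucky = CompatibleAt.agreeOnGap c 0 gap Sp≢unlucky
  weigh-run-gap {n} {p} p≤1+n {F} {F′} c (a ∷ u) {S} {S′} gap Sp≢unlucky = byMove (moveView n S a) (suc a ≟ p)
    where
    open CompatibleAt c
    a′ = punchInℕ p a
    u′ = List.map (punchInℕ p) u
    intoGap : S a ≢ free → suc a ≡ p → weigh F (run (suc n) S′ (a′ ∷ u′)) ≡ 0
    intoGap Sa≢free refl rewrite punchInℕ-< {suc a} {a} ≤-refl =
      weigh-run-intoTaken (suc n) S′ a u′ gapTaken
        (taken (trans (cong S′ (sym (punchInℕ-< {suc a} {a} ≤-refl))) (GapAt.agree gap a)) Sa≢free)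
    byMove : MoveView n S a → Dec (suc a ≡ p) → weigh F (run (suc n) S′ (a′ ∷ u′)) ≡ weigh F′ (run n S (a ∷ u))
    byMove (here ea e) _ = begin
      weigh F (run (suc n) S′ (a′ ∷ u′))
        ≡⟨ weigh-run-here (suc n) S′ a′ u′ F
             (cong (λ m → moveAt m (S′ (suc a′)) (suc a′ ≤ᵇ suc n)) (trans (GapAt.agree gap a) ea)) ⟩
      weigh (F ∘ suc) (run (suc n) (park S′ a′ luckyCar) u′)
        ≡⟨ weigh-run-gap p≤1+n (CompatibleAt-suc c) u (GapAt-park a luckyCar gap) (park-≢ S a luckyCar Sp≢unlucky (λ ())) ⟩
      weigh (F′ ∘ suc) (run n (park S a luckyCar) u)
        ≡⟨ weigh-run-here n S a u F′ e ⟨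
      weigh F′ (run n S (a ∷ u)) ∎
    byMove (next _ _ _ e) (no 1+a≢p) = begin
      weigh F (run (suc n) S′ (a′ ∷ u′))
        ≡⟨ weigh-run-next (suc n) S′ a′ u′ F (trans (move-gap a p≤1+n gap 1+a≢p) e) ⟩
      weigh F (run (suc n) (park S′ (suc a′) unluckyCar) u′)
        ≡⟨ cong (λ x → weigh F (run (suc n) (park S′ x unluckyCar) u′)) (punchInℕ-suc p a 1+a≢p) ⟩
      weigh F (run (suc n) (park S′ (punchInℕ p (suc a)) unluckyCar) u′)
        ≡⟨ weigh-run-gap p≤1+n c u (GapAt-park (suc a) unluckyCar gap)
             (λ q → Sp≢unlucky (trans (sym (park-other S (suc a) unluckyCar (1+a≢p ∘ sym))) q)) ⟩
      weigh F′ (run n (park S (suc a) unluckyCar) u)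
        ≡⟨ weigh-run-next n S a u F′ e ⟨
      weigh F′ (run n S (a ∷ u)) ∎
    byMove (next Sa≢free _ _ e) (yes 1+a≡p) = trans (intoGap Sa≢free 1+a≡p)
      (sym (trans (weigh-run-next n S a u F′ e)
                  (weigh-run-park n S (suc a) unluckyCar u (λ ())
                     (λ j {S″} eq → gapUnlucky j (subst (λ x → S″ x ≡ unluckyCar) 1+a≡p eq)))))
    byMove (blocked _ _ e) (no 1+a≢p) =
      trans (weigh-run-stuck (suc n) S′ a′ u′ F (trans (move-gap a p≤1+n gap 1+a≢p) e)) (sym (weigh-run-stuck n S a u F′ e))
    byMove (blocked Sa≢free _ e) (yes 1+a≡p) = trans (intoGap Sa≢free 1+a≡p) (sym (weigh-run-stuck n S a u F′ e))

  prefs : ∀ {N m} → Vec (Fin N) m → List ℕ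
  prefs v = List.map prefVal (toList v)

  prefs-bounded : ∀ {N m} (v : Vec (Fin N) m) → All (λ a → 1 ≤ a × a ≤ N) (prefs v)
  prefs-bounded [] = []
  prefs-bounded (x ∷ v) = (s≤s z≤n , toℕ<n x) ∷ prefs-bounded v

  length-prefs : ∀ {N m} (v : Vec (Fin N) m) → List.length (prefs v) ≡ m
  length-prefs [] = refl
  length-prefs (x ∷ v) = cong suc (length-prefs v)

  prefs-∷ʳ : ∀ {N m} (w : Vec (Fin N) m) x → prefs (w ∷ʳ x) ≡ prefs w ++ prefVal x ∷ []
  prefs-∷ʳ [] x = refl
  prefs-∷ʳ (y ∷ w) x = cong (prefVal y ∷_) (prefs-∷ʳ w x)

  prefs-punchIn : ∀ {N m} (i : Fin (suc N)) (u : Vec (Fin N) m) →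
                  prefs (Vec.map (punchIn i) u) ≡ List.map (punchInℕ (prefVal i)) (prefs u)
  prefs-punchIn i [] = refl
  prefs-punchIn i (y ∷ u) = cong₂ _∷_ (prefVal-punchIn i y) (prefs-punchIn i u)

  ∈-prefs : ∀ {N m} {i : Fin N} (w : Vec (Fin N) m) → i ∈ᵥ w → prefVal i ∈ prefs w
  ∈-prefs (x ∷ w) (Anyᵥ.here refl) = here refl
  ∈-prefs (x ∷ w) (Anyᵥ.there i∈w) = there (∈-prefs w i∈w)

  weighMove : (ℕ → Street → ℕ) → ℕ → Street → ℕ → ℕ → Move → ℕ
  weighMove F N S a j parkHere = F (suc j) (park S a luckyCar)
  weighMove F N S a j parkNext = F j (park S (suc a) unluckyCar)
  weighMove F N S a j stuck = 0

  weigh-run-∷ʳ : ∀ F N S as a →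
                 weigh F (run N S (as ++ a ∷ [])) ≡ weigh (λ j S′ → weighMove F N S′ a j (move N S′ a)) (run N S as)
  weigh-run-∷ʳ F N S [] a = lastMove (move N S a)
    where
    lastMove : ∀ m → weigh F (runAfter m N S a []) ≡ weighMove F N S a 0 m
    lastMove parkHere = refl
    lastMove parkNext = refl
    lastMove stuck = refl
  weigh-run-∷ʳ F N S (b ∷ as) a = firstMove (move N S b)
    where
    weighMove-suc : ∀ S j m → weighMove (F ∘ suc) N S a j m ≡ weighMove F N S a (suc j) m
    weighMove-suc S j parkHere = refl
    weighMove-suc S j parkNext = refl
    weighMove-suc S j stuck = refl
    firstMove : ∀ m → weigh F (runAfter m N S b (as ++ a ∷ [])) ≡
                      weigh (λ j S′ → weighMove F N S′ a j (move N S′ a)) (runAfter m N S b as)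
    firstMove parkHere = begin
      weigh F (Maybe.map (map₁ suc) (run N S′ (as ++ a ∷ [])))
        ≡⟨ weigh-map-suc F (run N S′ (as ++ a ∷ [])) ⟩
      weigh (F ∘ suc) (run N S′ (as ++ a ∷ []))
        ≡⟨ weigh-run-∷ʳ (F ∘ suc) N S′ as a ⟩
      weigh (λ j S″ → weighMove (F ∘ suc) N S″ a j (move N S″ a)) (run N S′ as)
        ≡⟨ weigh-cong (run N S′ as) (λ j S″ _ → weighMove-suc S″ j (move N S″ a)) ⟩
      weigh (λ j S″ → weighMove F N S″ a (suc j) (move N S″ a)) (run N S′ as)
        ≡⟨ weigh-map-suc _ (run N S′ as) ⟨
      weigh (λ j S″ → weighMove F N S″ a j (move N S″ a)) (Maybe.map (map₁ suc) (run N S′ as)) ∎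
      where S′ = park S b luckyCar
    firstMove parkNext = weigh-run-∷ʳ F N (park S (suc b) unluckyCar) as a
    firstMove stuck = refl

  -- Weight of a last car ending in spot q after j lucky cars: it is lucky if it prefers q, and
  -- unlucky if it prefers the taken spot q − 1.
  lastCarAt : ℕ → ℕ → ℕ → Street → ℕ
  lastCarAt k q j S = δ (suc j) k * 𝟙 (isFree (S q)) + δ j k * 𝟙 (isFree (S q) ∧ ((2 ≤ᵇ q) ∧ isTaken (S (q ∸ 1))))

  weighMove-δ : ∀ k N S a j → weighMove (λ j _ → δ j k) N S a j (move N S a) ≡
                δ (suc j) k * 𝟙 (isFree (S a)) + δ j k * 𝟙 ((suc a ≤ᵇ N) ∧ (isTaken (S a) ∧ isFree (S (suc a))))
  weighMove-δ k N S a j with moveView N S a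
  ... | here ea e rewrite e | ea | ∧-zeroʳ (suc a ≤ᵇ N) | *-identityʳ (δ (suc j) k) | *-zeroʳ (δ j k) =
    sym (+-identityʳ _)
  ... | next na eb sa≤N e rewrite e | isFree-taken na | isTaken-taken na | eb | ≤ᵇ-true sa≤N
                                    | *-identityʳ (δ j k) | *-zeroʳ (δ (suc j) k) = refl
  ... | blocked na (inj₁ nb) e rewrite e | isFree-taken na | isFree-taken nb | ∧-zeroʳ (isTaken (S a))
                                         | ∧-zeroʳ (suc a ≤ᵇ N) | *-zeroʳ (δ j k) | *-zeroʳ (δ (suc j) k) = refl
  ... | blocked na (inj₂ N<sa) e rewrite e | isFree-taken na | ≤ᵇ-false N<sa | *-zeroʳ (δ j k) | *-zeroʳ (δ (suc j) k) = refl

  sum-weighMove-δ : ∀ k n S j →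
    sumBelow (suc n) (λ t → weighMove (λ j _ → δ j k) (suc n) S (suc t) j (move (suc n) S (suc t))) ≡
    sumBelow (suc n) (λ t → lastCarAt k (suc t) j S)
  sum-weighMove-δ k n S j = begin
    sumBelow (suc n) (λ t → weighMove (λ j _ → δ j k) (suc n) S (suc t) j (move (suc n) S (suc t)))
      ≡⟨ sumBelow-cong (suc n) (λ t _ → weighMove-δ k (suc n) S (suc t) j) ⟩
    sumBelow (suc n) (λ t → luckyAt t + slideFrom t)
      ≡⟨ sumBelow-distrib-+ (suc n) luckyAt slideFrom ⟩
    sumBelow (suc n) luckyAt + sumBelow (suc n) slideFrom
      ≡⟨ cong (λ y → sumBelow (suc n) luckyAt + y) (sumBelow-shift n slideFrom slideInto intoFirst outOfRange shift) ⟩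
    sumBelow (suc n) luckyAt + sumBelow (suc n) slideInto
      ≡⟨ sumBelow-distrib-+ (suc n) luckyAt slideInto ⟨
    sumBelow (suc n) (λ t → lastCarAt k (suc t) j S) ∎
    where
    luckyAt slideFrom slideInto : ℕ → ℕ
    luckyAt t = δ (suc j) k * 𝟙 (isFree (S (suc t)))
    slideFrom t = δ j k * 𝟙 ((suc (suc t) ≤ᵇ suc n) ∧ (isTaken (S (suc t)) ∧ isFree (S (suc (suc t)))))
    slideInto t = δ j k * 𝟙 (isFree (S (suc t)) ∧ ((2 ≤ᵇ suc t) ∧ isTaken (S (suc t ∸ 1))))
    intoFirst : slideInto 0 ≡ 0
    intoFirst rewrite ∧-zeroʳ (isFree (S 1)) = *-zeroʳ (δ j k)
    outOfRange : slideFrom n ≡ 0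
    outOfRange rewrite ≤ᵇ-false {suc (suc n)} {suc n} ≤-refl = *-zeroʳ (δ j k)
    shift : ∀ t → t < n → slideFrom t ≡ slideInto (suc t)
    shift t t<n rewrite ≤ᵇ-true {suc (suc t)} {suc n} (s≤s t<n) =
      cong (λ b → δ j k * 𝟙 b) (∧-comm (isTaken (S (suc t))) (isFree (S (suc (suc t)))))

  -- lastCarAt k q read on the street from which the free spot q has been deleted: q stayed
  -- free exactly when no car slid onto the spot now numbered q.
  lastCarAtGap : ℕ → ℕ → ℕ → Street → ℕ
  lastCarAtGap k q j S =
    δ (suc j) k * 𝟙 (not (isUnlucky (S q))) + δ j k * 𝟙 (not (isUnlucky (S q)) ∧ ((2 ≤ᵇ q) ∧ isTaken (S (q ∸ 1))))

  takenBeforeGap : ∀ {p S S′} → GapAt p S S′ → (2 ≤ᵇ p) ∧ isTaken (S′ (p ∸ 1)) ≡ (2 ≤ᵇ p) ∧ isTaken (S (p ∸ 1))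
  takenBeforeGap {zero} _ = refl
  takenBeforeGap {suc zero} _ = refl
  takenBeforeGap {suc (suc r)} {S} {S′} gap =
    cong isTaken (trans (cong S′ (sym (punchInℕ-< {suc (suc r)} {suc r} ≤-refl))) (GapAt.agree gap (suc r)))

  lastCarAt-compatible : ∀ k p → CompatibleAt p (lastCarAt k p) (lastCarAtGap k p)
  lastCarAt-compatible k p = record { agreeOnGap = agreeOnGap ; gapTaken = gapTaken ; gapUnlucky = gapUnlucky }
    where
    agreeOnGap : ∀ j {S S′} → GapAt p S S′ → S p ≢ unluckyCar → lastCarAt k p j S′ ≡ lastCarAtGap k p j S
    agreeOnGap j gap Sp≢unlucky rewrite GapAt.gapFree gap | notUnlucky Sp≢unlucky =
      cong (λ b → δ (suc j) k * 1 + δ j k * 𝟙 b) (takenBeforeGap gap)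
    gapTaken : ∀ j {S′} → S′ p ≢ free → lastCarAt k p j S′ ≡ 0
    gapTaken j Sp≢free rewrite isFree-taken Sp≢free | *-zeroʳ (δ (suc j) k) | *-zeroʳ (δ j k) = refl
    gapUnlucky : ∀ j {S} → S p ≡ unluckyCar → lastCarAtGap k p j S ≡ 0
    gapUnlucky j Sp≡unlucky rewrite Sp≡unlucky | *-zeroʳ (δ (suc j) k) | *-zeroʳ (δ j k) = refl

  module _ {n S j} (occ : Occupancy n S n j) where
    open Occupancy occ

    full-taken : ∀ t → t < n → S (suc t) ≢ free
    full-taken t t<n St≡free
      with trans (sym (cong isTaken St≡free)) (sumBelow-𝟙≡⇒all n (λ t → isTaken (S (suc t))) #taken t t<n)
    ... | ()

    full-lastFree : not (isUnlucky (S (suc n))) ≡ true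
    full-lastFree with S (suc n) in eq
    ... | free = refl
    ... | luckyCar = ⊥-elim (<-irrefl refl (proj₂ (inRange (suc n) (taken eq (λ ())))))
    ... | unluckyCar = ⊥-elim (<-irrefl refl (proj₂ (inRange (suc n) (taken eq (λ ())))))

    full-#notUnlucky : sumBelow (suc n) (λ t → 𝟙 (not (isUnlucky (S (suc t))))) ≡ suc j
    full-#notUnlucky = begin
      sumBelow (suc n) (λ t → 𝟙 (not (isUnlucky (S (suc t)))))
        ≡⟨ sumBelow-suc n (λ t → 𝟙 (not (isUnlucky (S (suc t))))) ⟩
      sumBelow n (λ t → 𝟙 (not (isUnlucky (S (suc t))))) + 𝟙 (not (isUnlucky (S (suc n))))
        ≡⟨ cong₂ _+_ (sumBelow-cong n (λ t t<n → cong 𝟙 (notUnlucky≡isLucky (full-taken t t<n)))) (cong 𝟙 full-lastFree) ⟩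
      sumBelow n (λ t → 𝟙 (isLucky (S (suc t)))) + 1
        ≡⟨ cong (_+ 1) #lucky ⟩
      j + 1
        ≡⟨ +-comm j 1 ⟩
      suc j ∎

    full-#afterTaken : sumBelow (suc n) (λ t → 𝟙 (not (isUnlucky (S (suc t))) ∧ ((2 ≤ᵇ suc t) ∧ isTaken (S (suc t ∸ 1))))) ≡ j
    full-#afterTaken = suc-injective (begin
      suc (𝟙 (not (isUnlucky (S 1)) ∧ false) + sumBelow n afterTaken)
        ≡⟨ cong (λ b → suc (𝟙 b + sumBelow n afterTaken)) (∧-zeroʳ (not (isUnlucky (S 1)))) ⟩
      suc (sumBelow n afterTaken)
        ≡⟨ cong suc (sumBelow-cong n (λ t t<n → cong (λ b → 𝟙 (notUnluckyAt t ∧ b)) (isTaken-taken (full-taken t t<n)))) ⟩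
      suc (sumBelow n (λ t → 𝟙 (notUnluckyAt t ∧ true)))
        ≡⟨ cong suc (sumBelow-cong n (λ t _ → cong 𝟙 (∧-identityʳ (notUnluckyAt t)))) ⟩
      suc (sumBelow n (λ t → 𝟙 (notUnluckyAt t)))
        ≡⟨ cong (λ b → 𝟙 b + sumBelow n (λ t → 𝟙 (notUnluckyAt t)))
                (notUnlucky (λ S1≡unlucky → 2≰1 (unlucky≥2 1 S1≡unlucky))) ⟨
      sumBelow (suc n) (λ t → 𝟙 (not (isUnlucky (S (suc t)))))
        ≡⟨ full-#notUnlucky ⟩
      suc j ∎)
      where
      notUnluckyAt : ℕ → Bool
      notUnluckyAt t = not (isUnlucky (S (suc (suc t))))
      afterTaken : ℕ → ℕ
      afterTaken t = 𝟙 (notUnluckyAt t ∧ ((2 ≤ᵇ suc (suc t)) ∧ isTaken (S (suc t))))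
      2≰1 : ¬ 2 ≤ 1
      2≰1 (s≤s ())

  -- A full street offers the last car the j + 1 spots not holding an unlucky car (the free spot
  -- n + 1 included) to land in luckily, and the j spots right after a taken one to slide into.
  sum-lastCarAtGap : ∀ k n S j → Occupancy n S n j →
                     sumBelow (suc n) (λ t → lastCarAtGap k (suc t) j S) ≡ δ (suc j) k * suc j + δ j k * j
  sum-lastCarAtGap k n S j occ = begin
    sumBelow (suc n) (λ t → lastCarAtGap k (suc t) j S)
      ≡⟨ sumBelow-distrib-+ (suc n) (λ t → δ (suc j) k * notUnluckyAt t) (λ t → δ j k * afterTakenAt t) ⟩
    sumBelow (suc n) (λ t → δ (suc j) k * notUnluckyAt t) + sumBelow (suc n) (λ t → δ j k * afterTakenAt t)
      ≡⟨ cong₂ _+_ (*-distribˡ-sum {suc n} (δ (suc j) k) (notUnluckyAt ∘ toℕ))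
                   (*-distribˡ-sum {suc n} (δ j k) (afterTakenAt ∘ toℕ)) ⟨
    δ (suc j) k * sumBelow (suc n) notUnluckyAt + δ j k * sumBelow (suc n) afterTakenAt
      ≡⟨ cong₂ (λ x y → δ (suc j) k * x + δ j k * y) (full-#notUnlucky occ) (full-#afterTaken occ) ⟩
    δ (suc j) k * suc j + δ j k * j ∎
    where
    notUnluckyAt afterTakenAt : ℕ → ℕ
    notUnluckyAt t = 𝟙 (not (isUnlucky (S (suc t))))
    afterTakenAt t = 𝟙 (not (isUnlucky (S (suc t))) ∧ ((2 ≤ᵇ suc t) ∧ isTaken (S (suc t ∸ 1))))

  -- Counting by the number of lucky cars

  numWithLucky : ℕ → ℕ → ℕ
  numWithLucky N k = sumVecs N N (λ v → weigh (λ j _ → δ j k) (run N emptyStreet (prefs v)))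

  sumVecs-lastCarAt : ∀ k n (i : Fin (suc n)) →
    sumVecs (suc n) n (λ w → weigh (lastCarAt k (prefVal i)) (run (suc n) emptyStreet (prefs w))) ≡
    sumVecs n n (λ u → weigh (lastCarAtGap k (prefVal i)) (run n emptyStreet (prefs u)))
  sumVecs-lastCarAt k n i = begin
    sumVecs (suc n) n (λ w → weigh (lastCarAt k p) (run (suc n) emptyStreet (prefs w)))
      ≡⟨ sumVecs-punchIn n n i _ (λ w i∈w → weigh-vanishes (run (suc n) emptyStreet (prefs w))
           (λ j S eq → gapTaken j {S} (run-takes-preferences (suc n) emptyStreet (prefs w) (∈-prefs w i∈w) eq))) ⟩
    sumVecs n n (λ u → weigh (lastCarAt k p) (run (suc n) emptyStreet (prefs (Vec.map (punchIn i) u))))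
      ≡⟨ sumVecs-cong n n (λ u → cong (λ as → weigh (lastCarAt k p) (run (suc n) emptyStreet as)) (prefs-punchIn i u)) ⟩
    sumVecs n n (λ u → weigh (lastCarAt k p) (run (suc n) emptyStreet (List.map (punchInℕ p) (prefs u))))
      ≡⟨ sumVecs-cong n n (λ u → weigh-run-gap (toℕ<n i) (lastCarAt-compatible k p) (prefs u) (refl , λ _ → refl) (λ ())) ⟩
    sumVecs n n (λ u → weigh (lastCarAtGap k p) (run n emptyStreet (prefs u))) ∎
    where
    p = prefVal i
    open CompatibleAt (lastCarAt-compatible k p)

  sum-weigh-run-lastCar : ∀ k n (w : Vec (Fin (suc n)) n) →
    ∑[ x < suc n ] weigh (λ j _ → δ j k) (run (suc n) emptyStreet (prefs (w ∷ʳ x))) ≡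
    ∑[ i < suc n ] weigh (lastCarAt k (prefVal i)) (run (suc n) emptyStreet (prefs w))
  sum-weigh-run-lastCar k n w = begin
    ∑[ x < N ] weigh δk (run N emptyStreet (prefs (w ∷ʳ x)))
      ≡⟨ sum-cong-≗ {N} (λ x → trans (cong (λ as → weigh δk (run N emptyStreet as)) (prefs-∷ʳ w x))
                                     (weigh-run-∷ʳ δk N emptyStreet (prefs w) (prefVal x))) ⟩
    ∑[ x < N ] weigh (λ j S → weighMove δk N S (prefVal x) j (move N S (prefVal x))) X
      ≡⟨ weigh-sum N (λ x j S → weighMove δk N S (prefVal x) j (move N S (prefVal x))) X ⟩
    weigh (λ j S → ∑[ x < N ] weighMove δk N S (prefVal x) j (move N S (prefVal x))) X
      ≡⟨ weigh-cong X (λ j S _ → sum-weighMove-δ k n S j) ⟩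
    weigh (λ j S → ∑[ i < N ] lastCarAt k (prefVal i) j S) X
      ≡⟨ weigh-sum N (λ i → lastCarAt k (prefVal i)) X ⟨
    ∑[ i < N ] weigh (lastCarAt k (prefVal i)) X ∎
    where
    N = suc n
    X = run N emptyStreet (prefs w)
    δk : ℕ → Street → ℕ
    δk j _ = δ j k

  sum-weigh-run-lastCarAtGap : ∀ k n (u : Vec (Fin n) n) →
    ∑[ i < suc n ] weigh (lastCarAtGap k (prefVal i)) (run n emptyStreet (prefs u)) ≡
    weigh (λ j _ → δ (suc j) k * suc j + δ j k * j) (run n emptyStreet (prefs u))
  sum-weigh-run-lastCarAtGap k n u = trans (weigh-sum (suc n) (λ i → lastCarAtGap k (prefVal i)) (run n emptyStreet (prefs u)))
    (weigh-cong (run n emptyStreet (prefs u)) (λ j S eq → sum-lastCarAtGap k n S j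
      (subst (λ m → Occupancy n S m j) (length-prefs u)
        (run-Occupancy n emptyStreet (prefs u) (Occupancy-empty n) (prefs-bounded u) eq))))

  numWithLucky-suc : ∀ n k → numWithLucky (suc n) k ≡
    sumVecs n n (λ u → weigh (λ j _ → δ (suc j) k * suc j + δ j k * j) (run n emptyStreet (prefs u)))
  numWithLucky-suc n k = begin
    numWithLucky (suc n) k
      ≡⟨ sumVecs-∷ʳ N n (λ v → weigh (λ j _ → δ j k) (run N emptyStreet (prefs v))) ⟩
    sumVecs N n (λ w → ∑[ x < N ] weigh (λ j _ → δ j k) (run N emptyStreet (prefs (w ∷ʳ x))))
      ≡⟨ sumVecs-cong N n (sum-weigh-run-lastCar k n) ⟩
    sumVecs N n (λ w → ∑[ i < N ] weigh (lastCarAt k (prefVal i)) (run N emptyStreet (prefs w)))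
      ≡⟨ sumVecs-comm N n N (λ w i → weigh (lastCarAt k (prefVal i)) (run N emptyStreet (prefs w))) ⟩
    ∑[ i < N ] sumVecs N n (λ w → weigh (lastCarAt k (prefVal i)) (run N emptyStreet (prefs w)))
      ≡⟨ sum-cong-≗ {N} (sumVecs-lastCarAt k n) ⟩
    ∑[ i < N ] sumVecs n n (λ u → weigh (lastCarAtGap k (prefVal i)) (run n emptyStreet (prefs u)))
      ≡⟨ sumVecs-comm n n N (λ u i → weigh (lastCarAtGap k (prefVal i)) (run n emptyStreet (prefs u))) ⟨
    sumVecs n n (λ u → ∑[ i < N ] weigh (lastCarAtGap k (prefVal i)) (run n emptyStreet (prefs u)))
      ≡⟨ sumVecs-cong n n (sum-weigh-run-lastCarAtGap k n) ⟩
    sumVecs n n (λ u → weigh (λ j _ → δ (suc j) k * suc j + δ j k * j) (run n emptyStreet (prefs u))) ∎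
    where N = suc n

  surjections : ℕ → ℕ → ℕ
  surjections zero zero = 1
  surjections zero (suc k) = 0
  surjections (suc n) zero = 0
  surjections (suc n) (suc k) = suc k * (surjections n k + surjections n (suc k))

  numWithLucky≡surjections : ∀ n k → numWithLucky n k ≡ surjections n k
  numWithLucky≡surjections zero zero = refl
  numWithLucky≡surjections zero (suc k) = refl
  numWithLucky≡surjections (suc n) zero =
    trans (numWithLucky-suc n 0) (sumVecs-zero n n (λ u → weigh-vanishes (run n emptyStreet (prefs u)) (λ j _ _ → noneLucky j)))
    where
    noneLucky : ∀ j → δ (suc j) 0 * suc j + δ j 0 * j ≡ 0
    noneLucky zero = refl
    noneLucky (suc j) = refl
  numWithLucky≡surjections (suc n) (suc k) = begin
    numWithLucky (suc n) (suc k)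
      ≡⟨ numWithLucky-suc n (suc k) ⟩
    sumVecs n n (λ u → weigh (λ j _ → δ (suc j) (suc k) * suc j + δ j (suc k) * j) (X u))
      ≡⟨ sumVecs-cong n n (λ u → weigh-cong (X u) (λ j _ _ → factor j)) ⟩
    sumVecs n n (λ u → weigh (λ j _ → suc k * (δ j k + δ j (suc k))) (X u))
      ≡⟨ sumVecs-cong n n (λ u → weigh-distrib (X u)) ⟩
    sumVecs n n (λ u → suc k * (weigh (λ j _ → δ j k) (X u) + weigh (λ j _ → δ j (suc k)) (X u)))
      ≡⟨ *-distribˡ-sumVecs n n (suc k) _ ⟨
    suc k * sumVecs n n (λ u → weigh (λ j _ → δ j k) (X u) + weigh (λ j _ → δ j (suc k)) (X u))
      ≡⟨ cong (suc k *_) (sumVecs-distrib-+ n n _ _) ⟩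
    suc k * (numWithLucky n k + numWithLucky n (suc k))
      ≡⟨ cong₂ (λ a b → suc k * (a + b)) (numWithLucky≡surjections n k) (numWithLucky≡surjections n (suc k)) ⟩
    surjections (suc n) (suc k) ∎
    where
    X : Vec (Fin n) n → Maybe (ℕ × Street)
    X u = run n emptyStreet (prefs u)
    factor : ∀ j → δ (suc j) (suc k) * suc j + δ j (suc k) * j ≡ suc k * (δ j k + δ j (suc k))
    factor j = begin
      δ j k * suc j + δ j (suc k) * j         ≡⟨ cong₂ _+_ (δ-* (suc j) (suc k)) (δ-* j (suc k)) ⟩
      δ j k * suc k + δ j (suc k) * suc k     ≡⟨ *-distribʳ-+ (suc k) (δ j k) (δ j (suc k)) ⟨
      (δ j k + δ j (suc k)) * suc k           ≡⟨ *-comm _ (suc k) ⟩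
      suc k * (δ j k + δ j (suc k))           ∎
    weigh-distrib : ∀ Y → weigh (λ j _ → suc k * (δ j k + δ j (suc k))) Y ≡
                          suc k * (weigh (λ j _ → δ j k) Y + weigh (λ j _ → δ j (suc k)) Y)
    weigh-distrib nothing = sym (*-zeroʳ (suc k))
    weigh-distrib (just _) = refl

  isPosEven-2+2m : ∀ m → isPosEven (2 + 2 * m) ≡ true
  isPosEven-2+2m zero = refl
  isPosEven-2+2m (suc m) = trans (cong (λ x → isPosEven (2 + x)) (*-suc 2 m)) (isPosEven-2+2m m)

  isPosEven-3+2m : ∀ m → isPosEven (3 + 2 * m) ≡ false
  isPosEven-3+2m zero = refl
  isPosEven-3+2m (suc m) = trans (cong (λ x → isPosEven (3 + x)) (*-suc 2 m)) (isPosEven-3+2m m)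

  𝟙-isPosEven : ∀ m j → j ≤ suc (2 * m) → 𝟙 (isPosEven j) ≡ sumFrom1ℕ m (λ k → δ j (2 * k))
  𝟙-isPosEven zero zero _ = refl
  𝟙-isPosEven zero (suc zero) _ = refl
  𝟙-isPosEven zero (suc (suc j)) (s≤s ())
  𝟙-isPosEven (suc m) j j≤ with j ≤? suc (2 * m)
  ... | yes j≤1+2m = trans (𝟙-isPosEven m j j≤1+2m)
                            (sym (trans (cong (λ y → sumFrom1ℕ m (λ k → δ j (2 * k)) + y) (δ-≢ j≢top)) (+-identityʳ _)))
    where
    j≢top : j ≢ 2 * suc m
    j≢top refl = <-irrefl refl (subst (_≤ suc (2 * m)) (*-suc 2 m) j≤1+2m)
  ... | no j≰1+2m = trans (top (m≤n⇒m<n∨m≡n j≤)) (sym (cong (_+ δ j (2 * suc m)) lowerZero))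
    where
    2m+2≤j : 2 * suc m ≤ j
    2m+2≤j = subst (_≤ j) (sym (*-suc 2 m)) (≰⇒> j≰1+2m)
    lowerZero : sumFrom1ℕ m (λ k → δ j (2 * k)) ≡ 0
    lowerZero = sumFrom1ℕ-zero m _
      (λ k k≤m → δ-≢ (λ j≡2k → <⇒≱ (*-monoʳ-< 2 (s≤s k≤m)) (subst (2 * suc m ≤_) j≡2k 2m+2≤j)))
    top : j < suc (2 * suc m) ⊎ j ≡ suc (2 * suc m) → 𝟙 (isPosEven j) ≡ δ j (2 * suc m)
    top (inj₁ j<) with ≤-antisym (s≤s⁻¹ j<) 2m+2≤j
    ... | refl = trans (cong (λ x → 𝟙 (isPosEven x)) (*-suc 2 m)) (trans (cong 𝟙 (isPosEven-2+2m m)) (sym (δ-refl (2 * suc m))))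
    top (inj₂ refl) = trans (cong (λ x → 𝟙 (isPosEven (suc x))) (*-suc 2 m))
                            (trans (cong 𝟙 (isPosEven-3+2m m)) (sym (δ-≢ (1+n≢n {2 * suc m}))))

  length-filter≡sum : ∀ {A : Set} (b : A → Bool) xs →
    List.length (List.filter (λ x → b x Data.Bool.≟ true) xs) ≡ ListAction.sum (List.map (𝟙 ∘ b) xs)
  length-filter≡sum b [] = refl
  length-filter≡sum b (x ∷ xs) with b x
  ... | true = cong suc (length-filter≡sum b xs)
  ... | false = length-filter≡sum b xs

  isUPF∧posEven≡weigh : ∀ n (v : Vec (Fin n) n) →
    𝟙 (isUnitIntervalPF v ∧ isPosEven (lucky v)) ≡ weigh (λ j _ → 𝟙 (isPosEven j)) (run n emptyStreet (prefs v))
  isUPF∧posEven≡weigh n v = begin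
    𝟙 (isUnitIntervalPF v ∧ isPosEven (lucky v))
      ≡⟨ cong 𝟙 viaUnitLucky ⟩
    𝟙 (Maybe.maybe′ isPosEven false (unitLucky (prefs v) (outcome v)))
      ≡⟨ cong (𝟙 ∘ Maybe.maybe′ isPosEven false)
              (unitLucky∘parkAux≡run n [] emptyStreet (prefs v) Marks-empty (prefs-bounded v)) ⟩
    𝟙 (Maybe.maybe′ isPosEven false (Maybe.map proj₁ (run n emptyStreet (prefs v))))
      ≡⟨ byOutcome (run n emptyStreet (prefs v)) ⟩
    weigh (λ j _ → 𝟙 (isPosEven j)) (run n emptyStreet (prefs v)) ∎
    where
    viaUnitLucky : (isUnitIntervalPF v ∧ isPosEven (lucky v)) ≡ Maybe.maybe′ isPosEven false (unitLucky (prefs v) (outcome v))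
    viaUnitLucky with outcome v
    ... | nothing = refl
    ... | just ss with unitDisplaced (prefs v) ss
    ...   | true = refl
    ...   | false = refl
    byOutcome : ∀ X → 𝟙 (Maybe.maybe′ isPosEven false (Maybe.map proj₁ X)) ≡ weigh (λ j _ → 𝟙 (isPosEven j)) X
    byOutcome nothing = refl
    byOutcome (just _) = refl

  n≤1+2*[n/2] : ∀ n → n ≤ suc (2 * (n / 2))
  n≤1+2*[n/2] n = subst (_≤ suc (2 * (n / 2))) (sym (m≡m%n+[m/n]*n n 2))
    (+-mono-≤ (s≤s⁻¹ (m%n<n n 2)) (≤-reflexive (*-comm (n / 2) 2)))

  length-UPF-T1-posEven : ∀ n → List.length (UPF-T1-posEven n) ≡ sumFrom1ℕ (n / 2) (λ k → surjections n (2 * k))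
  length-UPF-T1-posEven n = begin
    List.length (UPF-T1-posEven n)
      ≡⟨ length-filter≡sum isUPF∧posEven (allVecs n n) ⟩
    ListAction.sum (List.map (𝟙 ∘ isUPF∧posEven) (allVecs n n))
      ≡⟨ sum-map-allVecs n n (𝟙 ∘ isUPF∧posEven) ⟩
    sumVecs n n (𝟙 ∘ isUPF∧posEven)
      ≡⟨ sumVecs-cong n n (isUPF∧posEven≡weigh n) ⟩
    sumVecs n n (λ v → weigh (λ j _ → 𝟙 (isPosEven j)) (X v))
      ≡⟨ sumVecs-cong n n (λ v → weigh-cong (X v)
           (λ j S eq → 𝟙-isPosEven (n / 2) j (≤-trans (lucky≤n v eq) (n≤1+2*[n/2] n)))) ⟩
    sumVecs n n (λ v → weigh (λ j _ → sumFrom1ℕ (n / 2) (λ k → δ j (2 * k))) (X v))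
      ≡⟨ sumVecs-cong n n (λ v → weigh-sumFrom1ℕ (n / 2) (λ k j _ → δ j (2 * k)) (X v)) ⟩
    sumVecs n n (λ v → sumFrom1ℕ (n / 2) (λ k → weigh (λ j _ → δ j (2 * k)) (X v)))
      ≡⟨ sumVecs-sumFrom1ℕ n n (n / 2) (λ k v → weigh (λ j _ → δ j (2 * k)) (X v)) ⟩
    sumFrom1ℕ (n / 2) (λ k → numWithLucky n (2 * k))
      ≡⟨ sumFrom1ℕ-cong (n / 2) (λ k → numWithLucky≡surjections n (2 * k)) ⟩
    sumFrom1ℕ (n / 2) (λ k → surjections n (2 * k)) ∎
    where
    isUPF∧posEven : Vec (Fin n) n → Bool
    isUPF∧posEven v = isUnitIntervalPF v ∧ isPosEven (lucky v)
    X : Vec (Fin n) n → Maybe (ℕ × Street)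
    X v = run n emptyStreet (prefs v)
    lucky≤n : ∀ v {j S} → X v ≡ just (j , S) → j ≤ n
    lucky≤n v {S = S} eq = subst (_≤ n) (Occupancy.#lucky occ) (sumBelow-𝟙≤ n (λ t → isLucky (S (suc t))))
      where occ = run-Occupancy n emptyStreet (prefs v) (Occupancy-empty n) (prefs-bounded v) eq

module InclusionExclusion where

  open import Data.Nat as ℕ using (ℕ; zero; suc; _^_)
  import Data.Nat.Properties as ℕ
  open import Data.Nat.Combinatorics using (_C_; nCk+nC[k+1]≡[n+1]C[k+1]; nC1≡n; k>n⇒nCk≡0)
  open import Data.Integer using (ℤ; +_; -_; _+_; _*_)
  open import Data.Integer.Properties
  open import Algebra.Properties.CommutativeSemigroup +-commutativeSemigroup using (interchange; x∙yz≈xz∙y)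
  open import Data.Integer.Tactic.RingSolver using (solve-∀)
  open import Data.Nat.Tactic.RingSolver using () renaming (solve-∀ to solveℕ)
  open import Function using (_∘_)
  open import Relation.Binary.PropositionalEquality
  open ≡-Reasoning
  open UnitIntervalCounting using (surjections; sumFrom1ℕ)

  [i+1]*[k+1]C[i+1]≡[k+1]*kCi : ∀ k i → suc i ℕ.* (suc k C suc i) ≡ suc k ℕ.* (k C i)
  [i+1]*[k+1]C[i+1]≡[k+1]*kCi zero zero = refl
  [i+1]*[k+1]C[i+1]≡[k+1]*kCi zero (suc i) = ℕ.*-zeroʳ (suc (suc i))
  [i+1]*[k+1]C[i+1]≡[k+1]*kCi (suc k) zero =
    trans (ℕ.+-identityʳ _) (trans (nC1≡n (suc (suc k))) (sym (ℕ.*-identityʳ (suc (suc k)))))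
  [i+1]*[k+1]C[i+1]≡[k+1]*kCi (suc k) (suc i) = begin
    suc (suc i) ℕ.* (suc (suc k) C suc (suc i))
      ≡⟨ cong (suc (suc i) ℕ.*_) (nCk+nC[k+1]≡[n+1]C[k+1] (suc k) (suc i)) ⟨
    suc (suc i) ℕ.* (a ℕ.+ b)
      ≡⟨ rearrange i a b ⟩
    a ℕ.+ (suc i ℕ.* a ℕ.+ suc (suc i) ℕ.* b)
      ≡⟨ cong₂ (λ x y → a ℕ.+ (x ℕ.+ y)) ([i+1]*[k+1]C[i+1]≡[k+1]*kCi k i) ([i+1]*[k+1]C[i+1]≡[k+1]*kCi k (suc i)) ⟩
    a ℕ.+ (suc k ℕ.* (k C i) ℕ.+ suc k ℕ.* (k C suc i))
      ≡⟨ cong (λ y → a ℕ.+ y) (ℕ.*-distribˡ-+ (suc k) (k C i) (k C suc i)) ⟨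
    a ℕ.+ suc k ℕ.* (k C i ℕ.+ k C suc i)
      ≡⟨ cong (λ x → a ℕ.+ suc k ℕ.* x) (nCk+nC[k+1]≡[n+1]C[k+1] k i) ⟩
    suc (suc k) ℕ.* a ∎
    where
    a = suc k C suc i
    b = suc k C suc (suc i)
    rearrange : ∀ i a b → suc (suc i) ℕ.* (a ℕ.+ b) ≡ a ℕ.+ (suc i ℕ.* a ℕ.+ suc (suc i) ℕ.* b)
    rearrange = solveℕ

  sumTo-cong : ∀ m {f g : ℕ → ℤ} → (∀ i → f i ≡ g i) → sumTo m f ≡ sumTo m g
  sumTo-cong zero f≗g = f≗g 0
  sumTo-cong (suc m) f≗g = cong₂ _+_ (sumTo-cong m f≗g) (f≗g (suc m))

  sumTo-unfoldˡ : ∀ m (f : ℕ → ℤ) → sumTo (suc m) f ≡ f 0 + sumTo m (f ∘ suc)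
  sumTo-unfoldˡ zero f = refl
  sumTo-unfoldˡ (suc m) f = trans (cong (_+ f (suc (suc m))) (sumTo-unfoldˡ m f)) (+-assoc (f 0) _ _)

  sumTo-distrib-+ : ∀ m (f g : ℕ → ℤ) → sumTo m (λ i → f i + g i) ≡ sumTo m f + sumTo m g
  sumTo-distrib-+ zero f g = refl
  sumTo-distrib-+ (suc m) f g =
    trans (cong (_+ (f (suc m) + g (suc m))) (sumTo-distrib-+ m f g)) (interchange (sumTo m f) (sumTo m g) _ _)

  *-distribˡ-sumTo : ∀ m c (f : ℕ → ℤ) → sumTo m (λ i → c * f i) ≡ c * sumTo m f
  *-distribˡ-sumTo zero c f = refl
  *-distribˡ-sumTo (suc m) c f = trans (cong (_+ c * f (suc m)) (*-distribˡ-sumTo m c f)) (sym (*-distribˡ-+ c _ _))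

  neg-distrib-sumTo : ∀ m (f : ℕ → ℤ) → sumTo m (λ i → - f i) ≡ - sumTo m f
  neg-distrib-sumTo zero f = refl
  neg-distrib-sumTo (suc m) f = trans (cong (_+ - f (suc m)) (neg-distrib-sumTo m f)) (sym (neg-distrib-+ (sumTo m f) (f (suc m))))

  sumTo-pascal : ∀ k (h : ℕ → ℤ) → sumTo (suc k) (λ i → + (suc k C i) * h i) ≡
    sumTo k (λ i → + (k C i) * h i) + sumTo k (λ i → + (k C i) * h (suc i))
  sumTo-pascal k h = begin
    sumTo (suc k) (λ i → + (suc k C i) * h i)
      ≡⟨ sumTo-unfoldˡ k _ ⟩
    + 1 * h 0 + sumTo k (λ i → + (suc k C suc i) * h (suc i))
      ≡⟨ cong (λ y → + 1 * h 0 + y) (trans (sumTo-cong k pascal) (sumTo-distrib-+ k _ _)) ⟩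
    + 1 * h 0 + (shifted + upper)
      ≡⟨ x∙yz≈xz∙y (+ 1 * h 0) shifted upper ⟩
    + 1 * h 0 + upper + shifted
      ≡⟨ cong (_+ shifted) dropTop ⟩
    sumTo k (λ i → + (k C i) * h i) + shifted ∎
    where
    shifted = sumTo k (λ i → + (k C i) * h (suc i))
    upper = sumTo k (λ i → + (k C suc i) * h (suc i))
    pascal : ∀ i → + (suc k C suc i) * h (suc i) ≡ + (k C i) * h (suc i) + + (k C suc i) * h (suc i)
    pascal i = begin
      + (suc k C suc i) * h (suc i)             ≡⟨ cong (λ x → + x * h (suc i)) (nCk+nC[k+1]≡[n+1]C[k+1] k i) ⟨
      + (k C i ℕ.+ k C suc i) * h (suc i)       ≡⟨ cong (_* h (suc i)) (pos-+ (k C i) (k C suc i)) ⟩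
      (+ (k C i) + + (k C suc i)) * h (suc i)   ≡⟨ *-distribʳ-+ (h (suc i)) (+ (k C i)) (+ (k C suc i)) ⟩
      + (k C i) * h (suc i) + + (k C suc i) * h (suc i) ∎
    dropTop : + 1 * h 0 + upper ≡ sumTo k (λ i → + (k C i) * h i)
    dropTop = begin
      + 1 * h 0 + upper
        ≡⟨ sumTo-unfoldˡ k (λ i → + (k C i) * h i) ⟨
      sumTo k (λ i → + (k C i) * h i) + + (k C suc k) * h (suc k)
        ≡⟨ cong (λ x → sumTo k (λ i → + (k C i) * h i) + + x * h (suc k)) (k>n⇒nCk≡0 (ℕ.n<1+n k)) ⟩
      sumTo k (λ i → + (k C i) * h i) + + 0 * h (suc k)
        ≡⟨ +-identityʳ _ ⟩
      sumTo k (λ i → + (k C i) * h i) ∎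

  alternatingSum : ℕ → ℕ → ℤ
  alternatingSum n k = sumTo k (λ i → + (k C i) * (signPow i * + (i ^ n)))

  shiftedAlternatingSum : ℕ → ℕ → ℤ
  shiftedAlternatingSum n k = sumTo k (λ i → + (k C i) * (signPow i * + (suc i ^ n)))

  alternatingSum-suc : ∀ n k → alternatingSum n (suc k) ≡ alternatingSum n k + - shiftedAlternatingSum n k
  alternatingSum-suc n k = trans (sumTo-pascal k (λ i → signPow i * + (i ^ n)))
    (cong (λ y → alternatingSum n k + y) (trans (sumTo-cong k (λ i → pullNeg (+ (k C i)) (signPow i) (+ (suc i ^ n))))
                                          (neg-distrib-sumTo k _)))
    where
    pullNeg : ∀ c s x → c * (- s * x) ≡ - (c * (s * x))
    pullNeg = solve-∀

  alternatingSum-suc-suc : ∀ n k → alternatingSum (suc n) (suc k) ≡ - (+ suc k * shiftedAlternatingSum n k)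
  alternatingSum-suc-suc n k = begin
    alternatingSum (suc n) (suc k)
      ≡⟨ sumTo-unfoldˡ k _ ⟩
    + 0 + sumTo k (λ i → + (suc k C suc i) * (signPow (suc i) * + (suc i ^ suc n)))
      ≡⟨ +-identityˡ _ ⟩
    sumTo k (λ i → + (suc k C suc i) * (signPow (suc i) * + (suc i ^ suc n)))
      ≡⟨ sumTo-cong k term ⟩
    sumTo k (λ i → - (+ suc k * (+ (k C i) * (signPow i * + (suc i ^ n)))))
      ≡⟨ neg-distrib-sumTo k _ ⟩
    - sumTo k (λ i → + suc k * (+ (k C i) * (signPow i * + (suc i ^ n))))
      ≡⟨ cong -_ (*-distribˡ-sumTo k (+ suc k) _) ⟩
    - (+ suc k * shiftedAlternatingSum n k) ∎
    where
    term : ∀ i → + (suc k C suc i) * (signPow (suc i) * + (suc i ^ suc n))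
               ≡ - (+ suc k * (+ (k C i) * (signPow i * + (suc i ^ n))))
    term i = begin
      + (suc k C suc i) * (- signPow i * + (suc i ℕ.* suc i ^ n))
        ≡⟨ cong (λ z → + (suc k C suc i) * (- signPow i * z)) (pos-* (suc i) (suc i ^ n)) ⟩
      + (suc k C suc i) * (- signPow i * (+ suc i * + (suc i ^ n)))
        ≡⟨ gather (+ (suc k C suc i)) (signPow i) (+ suc i) (+ (suc i ^ n)) ⟩
      - (+ suc i * + (suc k C suc i)) * (signPow i * + (suc i ^ n))
        ≡⟨ cong (λ z → - z * (signPow i * + (suc i ^ n))) absorb ⟩
      - (+ suc k * + (k C i)) * (signPow i * + (suc i ^ n))
        ≡⟨ scatter (+ suc k) (+ (k C i)) (signPow i) (+ (suc i ^ n)) ⟩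
      - (+ suc k * (+ (k C i) * (signPow i * + (suc i ^ n)))) ∎
      where
      absorb : + suc i * + (suc k C suc i) ≡ + suc k * + (k C i)
      absorb = begin
        + suc i * + (suc k C suc i)    ≡⟨ pos-* (suc i) (suc k C suc i) ⟨
        + (suc i ℕ.* (suc k C suc i))  ≡⟨ cong +_ ([i+1]*[k+1]C[i+1]≡[k+1]*kCi k i) ⟩
        + (suc k ℕ.* (k C i))          ≡⟨ pos-* (suc k) (k C i) ⟩
        + suc k * + (k C i)            ∎
      gather : ∀ c s a x → c * (- s * (a * x)) ≡ - (a * c) * (s * x)
      gather = solve-∀
      scatter : ∀ a b s x → - (a * b) * (s * x) ≡ - (a * (b * (s * x)))
      scatter = solve-∀

  alternatingSum≡±surjections : ∀ n k → alternatingSum n k ≡ signPow k * + surjections n k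
  alternatingSum≡±surjections zero zero = refl
  alternatingSum≡±surjections zero (suc k) =
    trans (alternatingSum-suc 0 k) (trans (+-inverseʳ (alternatingSum 0 k)) (sym (*-zeroʳ (signPow (suc k)))))
  alternatingSum≡±surjections (suc n) zero = refl
  alternatingSum≡±surjections (suc n) (suc k) = begin
    alternatingSum (suc n) (suc k)
      ≡⟨ alternatingSum-suc-suc n k ⟩
    - (+ suc k * shiftedAlternatingSum n k)
      ≡⟨ cong (λ z → - (+ suc k * z)) shifted≡difference ⟩
    - (+ suc k * (alternatingSum n k + - alternatingSum n (suc k)))
      ≡⟨ cong₂ (λ a b → - (+ suc k * (a + - b))) (alternatingSum≡±surjections n k) (alternatingSum≡±surjections n (suc k)) ⟩
    - (+ suc k * (s * + a + - (- s * + b)))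
      ≡⟨ collect s (+ suc k) (+ a) (+ b) ⟩
    - s * (+ suc k * (+ a + + b))
      ≡⟨ cong (λ z → - s * z) (trans (cong (+ suc k *_) (sym (pos-+ a b))) (sym (pos-* (suc k) (a ℕ.+ b)))) ⟩
    signPow (suc k) * + surjections (suc n) (suc k) ∎
    where
    s = signPow k
    a = surjections n k
    b = surjections n (suc k)
    collect : ∀ s c a b → - (c * (s * a + - (- s * b))) ≡ - s * (c * (a + b))
    collect = solve-∀
    solveFor : ∀ a w → w ≡ a + - (a + - w)
    solveFor = solve-∀
    shifted≡difference : shiftedAlternatingSum n k ≡ alternatingSum n k + - alternatingSum n (suc k)
    shifted≡difference = trans (solveFor (alternatingSum n k) _) (cong (λ z → alternatingSum n k + - z) (sym (alternatingSum-suc n k)))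

  signPow-even : ∀ k → signPow (2 ℕ.* k) ≡ + 1
  signPow-even zero = refl
  signPow-even (suc k) = trans (cong signPow (ℕ.*-suc 2 k)) (trans (neg-involutive (signPow (2 ℕ.* k))) (signPow-even k))

  +-sumFrom1ℕ : ∀ M (f : ℕ → ℕ) → + sumFrom1ℕ M f ≡ sumFrom1 M (λ k → + f k)
  +-sumFrom1ℕ zero f = refl
  +-sumFrom1ℕ (suc M) f = trans (pos-+ (sumFrom1ℕ M f) (f (suc M))) (cong (_+ + f (suc M)) (+-sumFrom1ℕ M f))

  sumFrom1-cong : ∀ M {f g : ℕ → ℤ} → (∀ k → f k ≡ g k) → sumFrom1 M f ≡ sumFrom1 M g
  sumFrom1-cong zero _ = refl
  sumFrom1-cong (suc M) f≗g = cong₂ _+_ (sumFrom1-cong M f≗g) (f≗g (suc M))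

  rhs≡sumFrom1-surjections : ∀ n → rhs n ≡ + sumFrom1ℕ (n ℕ./ 2) (λ k → surjections n (2 ℕ.* k))
  rhs≡sumFrom1-surjections n =
    trans (sumFrom1-cong (n ℕ./ 2) evenTerm) (sym (+-sumFrom1ℕ (n ℕ./ 2) (λ k → surjections n (2 ℕ.* k))))
    where
    evenTerm : ∀ k → sumTo (2 ℕ.* k) (λ i → + (2 ℕ.* k C i) * signPow i * + (i ^ n)) ≡ + surjections n (2 ℕ.* k)
    evenTerm k = begin
      sumTo (2 ℕ.* k) (λ i → + (2 ℕ.* k C i) * signPow i * + (i ^ n))
        ≡⟨ sumTo-cong (2 ℕ.* k) (λ i → *-assoc (+ (2 ℕ.* k C i)) (signPow i) (+ (i ^ n))) ⟩
      alternatingSum n (2 ℕ.* k)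
        ≡⟨ alternatingSum≡±surjections n (2 ℕ.* k) ⟩
      signPow (2 ℕ.* k) * + surjections n (2 ℕ.* k)
        ≡⟨ cong (_* + surjections n (2 ℕ.* k)) (signPow-even k) ⟩
      + 1 * + surjections n (2 ℕ.* k)
        ≡⟨ *-identityˡ _ ⟩
      + surjections n (2 ℕ.* k) ∎

corollary3p9 : (n : ℕ) → + length (UPF-T1-posEven n) ≡ rhs n
corollary3p9 n = trans (cong +_ (UnitIntervalCounting.length-UPF-T1-posEven n))
                       (sym (InclusionExclusion.rhs≡sumFrom1-surjections n))
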